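{- Let $\eta:A^*\to A^*$ be a substitution and $u\in A^{\mathbb{Z}}$ a two-sided periodic point of $\eta$ with growing seed $s=u_{ -1}|u_0$, and let $p\ge1$ be the period of $u$. Let $f:\mathbb{Z}\to\{0,1\}\mathcal{D}^*$ be a map. The following are equivalent: (1) $f=\mathrm{rep}_u$; (2) $f$ is increasing with respect to $\prec$, its image is $f(\mathbb{Z})=\bigcup_{\ell\in\mathbb{N}}\mathcal{L}_{\ell p+1}(\mathcal{A}_{\eta,s})\setminus\{0\,\mathtt{W}_{\min},1\,\mathtt{W}_{\max}\}\mathcal{D}^*$, and $f(0)=0$.
   Context: $A$ is a finite alphabet, $A^*$ the finite words, $\varepsilon$ the empty word, $|w|$ the length, $w[i]$ the $i$-th letter (from $0$). A substitution is a morphism $\eta:A^*\to A^*$ with $\eta(a)\neq\varepsilon$ for all $a$ and some letter growing ($|\eta^k(a)|\to\infty$). $\eta$ acts on $u\in A^{\mathbb{Z}}$ by $\eta(\cdots u_{ -1}|u_0\cdots)=\cdots\eta(u_{ -2})\eta(u_{ -1})|\eta(u_0)\eta(u_1)\cdots$ ($|$ separating positions $-1$ and $0$); $u$ is a periodic point if $\eta^p(u)=u$ for some $p\ge1$, its period is the least such $p$; the seed $u_{ -1}|u_0$ is growing if both letters are growing. A sequence $(m_i,a_i)_{i=0,\dots,k}$ in $A^*\times A$ is $x$-admissible if $m_{i-1}a_{i-1}$ is a prefix of $\eta(a_i)$ for $1\le i\le k$ and $m_ka_k$ is a prefix of $\eta(x)$. Let $\mathcal{D}=\{0,\dots,\max_c|\eta(c)|-1\}$;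 $\odot$ (or juxtaposition) is concatenation of words over $\mathcal{D}$. For $q\ge1$, $x\in A$, $0\le n<|\eta^q(x)|$ there is a unique $x$-admissible $(m_i,a_i)_{i=0,\dots,q-1}$ with $n=\sum_j|\eta^j(m_j)|$, and $\mathrm{tail}_{\eta,q,x}(n)=|m_{q-1}|\odot\cdots\odot|m_0|$. Set $\mathtt{W}_{\min}=0^p$, $\mathtt{W}_{\max}=\mathrm{tail}_{\eta,p,u_{ -1}}(|\eta^p(u_{ -1})|-1)$. Numeration system: for $n\ge1$ there are a unique $k$ divisible by $p$ and a unique $u_0$-admissible $(m_i,a_i)_{i=0,\dots,k-1}$ with $m_{k-1}\cdots m_{k-p}\ne\varepsilon$ and $u_0\cdots u_{n-1}=\eta^{k-1}(m_{k-1})\cdots\eta^0(m_0)$; for $n\le-2$ there are a unique $k$ divisible by $p$ and a unique $u_{ -1}$-admissible $(m_i,a_i)_{i=0,\dots,k-1}$ with $\eta^{p-1}(m_{k-1})\cdots\eta^0(m_{k-p})a_{k-p}\ne\eta^p(u_{ -1})$ and $u_{ -|\eta^k(u_{ -1})|}\cdots u_{n-1}=\eta^{k-1}(m_{k-1})\cdots\eta^0(m_0)$. Then $\mathrm{rep}_u(n)=0\odot|m_{k-1}|\odot\cdots\odot|m_0|$ ($n\ge1$), $\mathrm{rep}_u(0)=0$, $\mathrm{rep}_u(-1)=1$, $\mathrm{rep}_u(n)=1\odot|m_{k-1}|\odot\cdots\odot|m_0|$ ($n\le-2$). The automaton $\mathcal{A}_{\eta,s}$ has states $A\cup\{\mathtt{start}\}$,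 initial state $\mathtt{start}$, accepting states $A$, partial transitions $\delta(\mathtt{start},0)=u_0$, $\delta(\mathtt{start},1)=u_{ -1}$, $\delta(c,i)=\eta(c)[i]$ for $c\in A$, $0\le i<|\eta(c)|$, extended to words; $\mathcal{L}_q(\mathcal{A}_{\eta,s})$ is the set of words $w\in\mathcal{D}^*$ of length $q$ with $\delta(\mathtt{start},w)$ defined and in $A$. Orders: $<_{lex}$ lexicographic on $\mathcal{D}^*$; $u<_{rad}v$ iff $|u|<|v|$ or ($|u|=|v|$ and $u<_{lex}v$); $u<_{rev}v$ iff $|u|>|v|$ or ($|u|=|v|$ and $u<_{lex}v$); for $u,v\in\{0,1\}\mathcal{D}^*$, $u\prec v$ iff ($u\in1\mathcal{D}^*$, $v\in0\mathcal{D}^*$) or ($u,v\in0\mathcal{D}^*$, $u<_{rad}v$) or ($u,v\in1\mathcal{D}^*$, $u<_{rev}v$). -}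

module Defs where

open import Data.Nat as ℕ using (ℕ; zero; suc; _≤_; _<_; _∸_; _⊔_)
open import Data.Integer as ℤ using (ℤ; +_; -_; -[1+_]; +[1+_])
open import Data.Fin using (Fin)
open import Data.List using (List; []; _∷_; _++_; _∷ʳ_; concatMap; map; length; upTo; replicate; reverse; drop; foldr; allFin; concat)
open import Data.List.Relation.Unary.All using (All)
open import Data.Maybe using (Maybe; just; nothing) renaming (map to mapMaybe)
open import Data.Product using (Σ; ∃; _×_; _,_; proj₁; proj₂)
open import Data.Sum using (_⊎_)
open import Data.Empty using (⊥)
open import Data.Unit using (⊤)
open import Relation.Nullary using (¬_)
open import Relation.Binary.PropositionalEquality using (_≡_; _≢_)

module _ {k : ℕ} where

  Morphism : Set
  Morphism = Fin k → List (Fin k)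

  onWord : Morphism → List (Fin k) → List (Fin k)
  onWord θ = concatMap θ

  pow : Morphism → ℕ → Morphism
  pow η zero    a = a ∷ []
  pow η (suc j) a = onWord η (pow η j a)

  Prefix : {X : Set} → List X → List X → Set
  Prefix w v = ∃ λ z → w ++ z ≡ v

  nth : {X : Set} → List X → ℕ → Maybe X
  nth []       _       = nothing
  nth (x ∷ xs) zero    = just x
  nth (x ∷ xs) (suc i) = nth xs i

  Growing : Morphism → Fin k → Set
  Growing η a = ∀ N → ∃ λ K → ∀ j → K ≤ j → N ≤ length (pow η j a)

  IsSubstitution : Morphism → Set
  IsSubstitution η = (∀ a → η a ≢ []) × (∃ λ a → Growing η a)

  segment : (ℤ → Fin k) → ℤ → ℕ → List (Fin k)
  segment u a len = map (λ i → u (a ℤ.+ + i)) (upTo len)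

  -- v = θ(u) for the action of θ on A^ℤ:
  -- θ(u_0 ⋯ u_{n-1}) is the factor of v starting at position 0, and
  -- θ(u_{-n} ⋯ u_{-1}) is the factor of v ending at position -1, for all n.
  IsImage : Morphism → (ℤ → Fin k) → (ℤ → Fin k) → Set
  IsImage θ u v = ∀ (n : ℕ) →
      (segment v (+ 0) (length (onWord θ (segment u (+ 0) n)))
         ≡ onWord θ (segment u (+ 0) n))
    × (segment v (- (+ length (onWord θ (segment u (- (+ n)) n))))
                 (length (onWord θ (segment u (- (+ n)) n)))
         ≡ onWord θ (segment u (- (+ n)) n))

  FixedBy : Morphism → ℕ → (ℤ → Fin k) → Set
  FixedBy η q u = IsImage (pow η q) u u

  IsPeriod : Morphism → (ℤ → Fin k) → ℕ → Set
  IsPeriod η u p = (1 ≤ p) × FixedBy η p u × (∀ q → 1 ≤ q → q < p → ¬ FixedBy η q u)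

  GrowingSeed : Morphism → (ℤ → Fin k) → Set
  GrowingSeed η u = Growing η (u -[1+ 0 ]) × Growing η (u (+ 0))

  -- Admissible sequences.  A sequence (m_i,a_i)_{i=0..q-1} is the list
  -- (m_0,a_0) ∷ (m_1,a_1) ∷ ⋯ ∷ (m_{q-1},a_{q-1}).

  Seq : Set
  Seq = List (List (Fin k) × Fin k)

  Admissible : Morphism → Fin k → Seq → Set
  Admissible η x []                          = ⊤
  Admissible η x ((m , a) ∷ [])              = Prefix (m ∷ʳ a) (η x)
  Admissible η x ((m , a) ∷ (m' , a') ∷ r)   =
    Prefix (m ∷ʳ a) (η a') × Admissible η x ((m' , a') ∷ r)

  valueFrom : Morphism → ℕ → Seq → List (Fin k)
  valueFrom η i []            = []
  valueFrom η i ((m , a) ∷ r) = valueFrom η (suc i) r ++ onWord (pow η i) m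

  value : Morphism → Seq → List (Fin k)
  value η = valueFrom η 0

  digits : Seq → List ℕ
  digits s = reverse (map (λ ma → length (proj₁ ma)) s)

  topBlock : ℕ → Seq → Seq
  topBlock p s = drop (length s ∸ p) s

  firstLetter : Seq → Maybe (Fin k)
  firstLetter []            = nothing
  firstLetter ((m , a) ∷ _) = just a

  -- tail_{η,q,x}(n) = w  (defined through the unique x-admissible sequence
  -- of length q with n = Σ_j |η^j(m_j)|)

  IsTail : Morphism → ℕ → Fin k → ℕ → List ℕ → Set
  IsTail η q x n w = ∃ λ (s : Seq) →
    (length s ≡ q) × Admissible η x s × (length (value η s) ≡ n) × (w ≡ digits s)

  IsWmax : Morphism → (ℤ → Fin k) → ℕ → List ℕ → Set
  IsWmax η u p W = IsTail η p (u -[1+ 0 ]) (length (pow η p (u -[1+ 0 ])) ∸ 1) W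

  -- rep_u, given as the relation "rep_u(n) = w" following the paper's
  -- definition (the admissible sequence is unique, so this is a graph of
  -- a function).

  RepPos : Morphism → (ℤ → Fin k) → ℕ → ℕ → List ℕ → Set
  RepPos η u p n w = ∃ λ j → ∃ λ (s : Seq) →
      (length s ≡ suc j ℕ.* p)
    × Admissible η (u (+ 0)) s
    × (concat (map proj₁ (topBlock p s)) ≢ [])
    × (segment u (+ 0) n ≡ value η s)
    × (w ≡ 0 ∷ digits s)

  RepNeg : Morphism → (ℤ → Fin k) → ℕ → ℤ → List ℕ → Set
  RepNeg η u p n w = ∃ λ j → ∃ λ (s : Seq) →
      (length s ≡ suc j ℕ.* p)
    × Admissible η (u -[1+ 0 ]) s
    × (∃ λ a → (firstLetter (topBlock p s) ≡ just a)
             × ((value η (topBlock p s) ∷ʳ a) ≢ pow η p (u -[1+ 0 ])))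
    × (∃ λ len →
          ((- (+ length (pow η (length s) (u -[1+ 0 ])))) ℤ.+ + len ≡ n)
        × (segment u (- (+ length (pow η (length s) (u -[1+ 0 ])))) len ≡ value η s))
    × (w ≡ 1 ∷ digits s)

  IsRep : Morphism → (ℤ → Fin k) → ℕ → ℤ → List ℕ → Set
  IsRep η u p (+ zero)          w = w ≡ 0 ∷ []
  IsRep η u p +[1+ n ]          w = RepPos η u p (suc n) w
  IsRep η u p -[1+ zero ]       w = w ≡ 1 ∷ []
  IsRep η u p (-[1+ suc n ])    w = RepNeg η u p (-[1+ suc n ]) w

  maxLen : Morphism → ℕ
  maxLen η = foldr (λ c r → length (η c) ⊔ r) 0 (allFin k)

  InLeadD : Morphism → List ℕ → Set
  InLeadD η []      = ⊥
  InLeadD η (d ∷ r) = (d ≤ 1) × All (λ i → i < maxLen η) r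

  data State : Set where
    start : State
    st    : Fin k → State

  δ : Morphism → (ℤ → Fin k) → State → ℕ → Maybe State
  δ η u start zero          = just (st (u (+ 0)))
  δ η u start (suc zero)    = just (st (u -[1+ 0 ]))
  δ η u start (suc (suc _)) = nothing
  δ η u (st c) i            = mapMaybe st (nth (η c) i)

  δ* : Morphism → (ℤ → Fin k) → State → List ℕ → Maybe State
  δ* η u q []      = just q
  δ* η u q (i ∷ w) with δ η u q i
  ... | nothing = nothing
  ... | just q' = δ* η u q' w

  Accepted : Morphism → (ℤ → Fin k) → List ℕ → Set
  Accepted η u w = ∃ λ c → δ* η u start w ≡ just (st c)

  InImageSet : Morphism → (ℤ → Fin k) → ℕ → List ℕ → Set
  InImageSet η u p w =
      (∃ λ ℓ → length w ≡ ℓ ℕ.* p ℕ.+ 1)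
    × Accepted η u w
    × ¬ Prefix (0 ∷ replicate p 0) w
    × ¬ (∃ λ W → IsWmax η u p W × Prefix (1 ∷ W) w)

data _<lex_ : List ℕ → List ℕ → Set where
  []<  : ∀ {y ys} → [] <lex (y ∷ ys)
  here : ∀ {x y xs ys} → x < y → (x ∷ xs) <lex (y ∷ ys)
  there : ∀ {x xs ys} → xs <lex ys → (x ∷ xs) <lex (x ∷ ys)

_<rad_ : List ℕ → List ℕ → Set
u <rad v = (length u < length v) ⊎ ((length u ≡ length v) × u <lex v)

_<rev_ : List ℕ → List ℕ → Set
u <rev v = (length v < length u) ⊎ ((length u ≡ length v) × u <lex v)

data _≺_ : List ℕ → List ℕ → Set where
  neg<pos : ∀ u v → (1 ∷ u) ≺ (0 ∷ v)
  pos<pos : ∀ u v → (0 ∷ u) <rad (0 ∷ v) → (0 ∷ u) ≺ (0 ∷ v)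
  neg<neg : ∀ u v → (1 ∷ u) <rev (1 ∷ v) → (1 ∷ u) ≺ (1 ∷ v)

Increasing : (ℤ → List ℕ) → Set
Increasing f = ∀ m n → m ℤ.< n → f m ≺ f n

{-# OPTIONS --safe #-}
-- Positions n ≥ 1 are read off the fixed prefixes η^{jp}(u₀) of u: the tail of n in η^{(j+1)p}(u₀) is a
-- u₀-admissible sequence of length (j+1)p, and its top p words are not all empty exactly when
-- |η^{jp}(u₀)| ≤ n, i.e. when j is the level of n. Among admissible sequences of one length, the length of
-- η^{q-1}(m_{q-1}) ⋯ η^0(m_0) increases with the digit word in lexicographic order, so rep_u is ≺-increasing.
-- The digit words of admissible sequences are the runs of A_{η,s}, and the two excluded prefixes are the
-- conditions on the top block. Positions n ≤ -2 are symmetric, with the suffixes η^{jp}(u₋₁) of u and W_max.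
-- Hence rep_u is a ≺-increasing bijection from ℤ onto the language of (2), and any f as in (2) is rep_u
-- composed with an increasing bijection of ℤ fixing 0, which is the identity.

module Submission where

open import Defs
open import Data.Nat as ℕ using (ℕ; zero; suc; _+_; _*_; _∸_; _≤_; _<_; z≤n; s≤s; _<?_)
open import Data.Nat.Properties
open import Data.Integer as ℤ using (ℤ; +_; -_; -[1+_]; +[1+_])
import Data.Integer.Properties as ℤ
open import Data.Fin using (Fin)
open import Data.List
  using (List; []; _∷_; _++_; _∷ʳ_; length; map; concat; reverse; replicate; take; applyUpTo; upTo)
open import Data.List.Properties
  using (length-++; ++-assoc; ++-identityʳ; ++-conicalˡ; ++-conicalʳ; ∷-injective; ∷ʳ-injective; map-++; concatMap-++;
         unfold-reverse; reverse-++; length-reverse; length-map; length-replicate; length-upTo; map-upTo; map-cong; map-∘;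
         take++drop≡id; length-take; length-drop)
open import Data.Maybe using (just; nothing)
open import Data.Maybe.Properties using (just-injective)
open import Data.Product using (Σ; ∃; _×_; _,_; proj₁; proj₂)
open import Data.Sum using (inj₁; inj₂)
open import Data.Empty using (⊥-elim)
open import Data.Unit using (tt)
open import Function.Base using (case_of_)
open import Function.Bundles using (_⇔_; mk⇔; Equivalence)
open import Relation.Nullary using (¬_; yes; no)
open import Relation.Binary.Definitions using (tri<; tri≈; tri>)
open import Relation.Binary.PropositionalEquality

module _ {X : Set} where

  infix 4 _⊑_
  _⊑_ : List X → List X → Set
  w ⊑ v = ∃ λ z → w ++ z ≡ v

  length-∷ʳ : ∀ (m : List X) a → length (m ∷ʳ a) ≡ suc (length m)
  length-∷ʳ m a = trans (length-++ m) (+-comm (length m) 1)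

  length≡0⇒[] : ∀ {w : List X} → length w ≡ 0 → w ≡ []
  length≡0⇒[] {[]} _ = refl

  ⊑-length : ∀ {w v} → w ⊑ v → length w ≤ length v
  ⊑-length {w} (z , refl) = subst (length w ≤_) (sym (length-++ w)) (m≤m+n _ _)

  ⊑-refl : ∀ w → w ⊑ w
  ⊑-refl w = [] , ++-identityʳ w

  ⊑-trans : ∀ {a b c} → a ⊑ b → b ⊑ c → a ⊑ c
  ⊑-trans {a} (z , refl) (z′ , refl) = z ++ z′ , sym (++-assoc a z z′)

  ⊑-++ : ∀ a b → a ⊑ a ++ b
  ⊑-++ a b = b , refl

  ∷⁺-⊑ : ∀ {x a b} → a ⊑ b → x ∷ a ⊑ x ∷ b
  ∷⁺-⊑ (z , e) = z , cong (_ ∷_) e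

  ∷⁻-⊑ : ∀ {x y a b} → x ∷ a ⊑ y ∷ b → x ≡ y × a ⊑ b
  ∷⁻-⊑ (z , refl) = refl , (z , refl)

  ++⁺ˡ-⊑ : ∀ c {a b} → a ⊑ b → c ++ a ⊑ c ++ b
  ++⁺ˡ-⊑ []      p = p
  ++⁺ˡ-⊑ (x ∷ c) p = ∷⁺-⊑ (++⁺ˡ-⊑ c p)

  ⊑-common : ∀ {a b c} → a ⊑ c → b ⊑ c → length a ≤ length b → a ⊑ b
  ⊑-common {[]}              _  _  _       = _ , refl
  ⊑-common {_ ∷ _} {[]}      _  _  ()
  ⊑-common {_ ∷ _} {_ ∷ _} {[]} (_ , ()) _ _
  ⊑-common {_ ∷ _} {_ ∷ _} {_ ∷ _} pa pb (s≤s l) with ∷⁻-⊑ pa | ∷⁻-⊑ pb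
  ... | refl , pa′ | refl , pb′ = ∷⁺-⊑ (⊑-common pa′ pb′ l)

  ⊑-common-≡ : ∀ {a b c} → a ⊑ c → b ⊑ c → length a ≡ length b → a ≡ b
  ⊑-common-≡ {[]}    {[]}              _  _  _ = refl
  ⊑-common-≡ {_ ∷ _} {_ ∷ _} {[]}      (_ , ()) _ _
  ⊑-common-≡ {x ∷ _} {_ ∷ _} {_ ∷ _}   pa pb e with ∷⁻-⊑ pa | ∷⁻-⊑ pb
  ... | refl , pa′ | refl , pb′ = cong (x ∷_) (⊑-common-≡ pa′ pb′ (suc-injective e))

  ⊑-length-≡ : ∀ {a b} → a ⊑ b → length a ≡ length b → a ≡ b
  ⊑-length-≡ {b = b} p = ⊑-common-≡ p (⊑-refl b)

  ∷ʳ-⊑-length : ∀ {m a v} → m ∷ʳ a ⊑ v → length m < length v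
  ∷ʳ-⊑-length {m} {a} p = subst (_≤ _) (length-∷ʳ m a) (⊑-length p)

  ∷ʳ-⊑-unique : ∀ {m m′ a a′ v} → m ∷ʳ a ⊑ v → m′ ∷ʳ a′ ⊑ v → length m ≡ length m′ →
                m ≡ m′ × a ≡ a′
  ∷ʳ-⊑-unique {m} {m′} {a} {a′} p q e =
    ∷ʳ-injective m m′ (⊑-common-≡ p q (trans (length-∷ʳ m a) (trans (cong suc e) (sym (length-∷ʳ m′ a′)))))

  ∷ʳ-⊑-of-length : ∀ v n → n < length v → ∃ λ m → ∃ λ a → m ∷ʳ a ⊑ v × length m ≡ n
  ∷ʳ-⊑-of-length (x ∷ v) zero    _       = [] , x , (v , refl) , refl
  ∷ʳ-⊑-of-length (x ∷ v) (suc n) (s≤s l) with ∷ʳ-⊑-of-length v n l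
  ... | m , a , p , e = x ∷ m , a , ∷⁺-⊑ p , cong suc e

  ⊑-∷ʳ⁻ : ∀ {v w c} → v ⊑ w ∷ʳ c → v ≢ w ∷ʳ c → v ⊑ w
  ⊑-∷ʳ⁻ {v} {w} {c} p v≢ with <-cmp (length v) (suc (length w))
  ... | tri< (s≤s lt) _ _ = ⊑-common p (⊑-++ w (c ∷ [])) lt
  ... | tri≈ _ eq _ = ⊥-elim (v≢ (⊑-length-≡ p (trans eq (sym (length-∷ʳ w c)))))
  ... | tri> _ _ gt = ⊥-elim (<-irrefl refl (<-≤-trans gt (subst (length v ≤_) (length-∷ʳ w c) (⊑-length p))))

<lex-irrefl : ∀ {xs} → ¬ xs <lex xs
<lex-irrefl (here x<x) = <-irrefl refl x<x
<lex-irrefl (there l)  = <lex-irrefl l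

<lex-asym : ∀ {xs ys} → xs <lex ys → ¬ ys <lex xs
<lex-asym []<        ()
<lex-asym (here x<y) (here y<x) = <-asym x<y y<x
<lex-asym (here x<x) (there _)  = <-irrefl refl x<x
<lex-asym (there _)  (here x<x) = <-irrefl refl x<x
<lex-asym (there l)  (there l′) = <lex-asym l l′

<lex-++ : ∀ {xs ys} zs ws → xs <lex ys → length xs ≡ length ys → (xs ++ zs) <lex (ys ++ ws)
<lex-++ zs ws []<        ()
<lex-++ zs ws (here x<y) _ = here x<y
<lex-++ zs ws (there l)  e = there (<lex-++ zs ws l (suc-injective e))

<lex-∷ʳ : ∀ xs {a b} → a < b → (xs ∷ʳ a) <lex (xs ∷ʳ b)
<lex-∷ʳ []       a<b = here a<b
<lex-∷ʳ (_ ∷ xs) a<b = there (<lex-∷ʳ xs a<b)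

≺-irrefl : ∀ {w} → ¬ w ≺ w
≺-irrefl (pos<pos _ _ (inj₁ l))       = <-irrefl refl l
≺-irrefl (pos<pos _ _ (inj₂ (_ , l))) = <lex-irrefl l
≺-irrefl (neg<neg _ _ (inj₁ l))       = <-irrefl refl l
≺-irrefl (neg<neg _ _ (inj₂ (_ , l))) = <lex-irrefl l

≺-asym : ∀ {w w′} → w ≺ w′ → ¬ w′ ≺ w
≺-asym (neg<pos _ _) ()
≺-asym (pos<pos _ _ (inj₁ l))       (pos<pos _ _ (inj₁ l′))       = <-asym l l′
≺-asym (pos<pos _ _ (inj₁ l))       (pos<pos _ _ (inj₂ (e , _)))  = <-irrefl (sym e) l
≺-asym (pos<pos _ _ (inj₂ (e , _))) (pos<pos _ _ (inj₁ l′))       = <-irrefl (sym e) l′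
≺-asym (pos<pos _ _ (inj₂ (_ , l))) (pos<pos _ _ (inj₂ (_ , l′))) = <lex-asym l l′
≺-asym (neg<neg _ _ (inj₁ l))       (neg<neg _ _ (inj₁ l′))       = <-asym l l′
≺-asym (neg<neg _ _ (inj₁ l))       (neg<neg _ _ (inj₂ (e , _)))  = <-irrefl e l
≺-asym (neg<neg _ _ (inj₂ (e , _))) (neg<neg _ _ (inj₁ l′))       = <-irrefl e l′
≺-asym (neg<neg _ _ (inj₂ (_ , l))) (neg<neg _ _ (inj₂ (_ , l′))) = <lex-asym l l′

-- Strictly increasing maps and their graphs

i<suc[i] : ∀ {i} → i ℤ.< ℤ.suc i
i<suc[i] = ℤ.suc[i]≤j⇒i<j ℤ.≤-refl

sucℤ-injective : ∀ {i j} → ℤ.suc i ≡ ℤ.suc j → i ≡ j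
sucℤ-injective {i} {j} e = trans (sym (ℤ.pred-suc i)) (trans (cong ℤ.pred e) (ℤ.pred-suc j))

module _ (g : ℤ → ℤ) (g-increasing : ∀ m n → m ℤ.< n → g m ℤ.< g n)
         (g-surjective : ∀ z → ∃ λ n → g n ≡ z) where

  increasing-surjection-suc : ∀ n → g (ℤ.suc n) ≡ ℤ.suc (g n)
  increasing-surjection-suc n with g-surjective (ℤ.suc (g n))
  ... | m , gm≡ with ℤ.<-cmp m (ℤ.suc n)
  ... | tri≈ _ refl _ = gm≡
  ... | tri> _ _ n+1<m = ⊥-elim (ℤ.<-irrefl refl
    (ℤ.<-≤-trans (subst (g (ℤ.suc n) ℤ.<_) gm≡ (g-increasing _ _ n+1<m))
                 (ℤ.i<j⇒suc[i]≤j (g-increasing n (ℤ.suc n) i<suc[i]))))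
  ... | tri< m<n+1 _ _ with ℤ.<-cmp m n
  ...   | tri< m<n _ _ = ⊥-elim (ℤ.<-asym (subst (ℤ._< g n) gm≡ (g-increasing _ _ m<n)) i<suc[i])
  ...   | tri≈ _ refl _ = ⊥-elim (ℤ.i≢suc[i] gm≡)
  ...   | tri> _ _ n<m = ⊥-elim (ℤ.<-irrefl refl (ℤ.<-≤-trans m<n+1 (ℤ.i<j⇒suc[i]≤j n<m)))

  increasing-surjection-id : g (+ 0) ≡ + 0 → ∀ n → g n ≡ n
  increasing-surjection-id g0 (+ zero)       = g0
  increasing-surjection-id g0 (+ suc n)      =
    trans (increasing-surjection-suc (+ n)) (cong ℤ.suc (increasing-surjection-id g0 (+ n)))
  increasing-surjection-id g0 -[1+ zero ]    =
    sucℤ-injective (trans (sym (increasing-surjection-suc -[1+ 0 ])) g0)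
  increasing-surjection-id g0 -[1+ suc n ]   =
    sucℤ-injective (trans (sym (increasing-surjection-suc -[1+ suc n ])) (increasing-surjection-id g0 -[1+ n ]))

module GraphCharacterisation
  (Rep : ℤ → List ℕ → Set) (Img : List ℕ → Set)
  (rep-total      : ∀ n → ∃ (Rep n))
  (rep-functional : ∀ {n w w′} → Rep n w → Rep n w′ → w ≡ w′)
  (rep-increasing : ∀ {m n w w′} → Rep m w → Rep n w′ → m ℤ.< n → w ≺ w′)
  (rep-into       : ∀ {n w} → Rep n w → Img w)
  (rep-onto       : ∀ {w} → Img w → ∃ λ n → Rep n w)
  {w₀ : List ℕ} (rep-0 : Rep (+ 0) w₀) where

  rep-injective : ∀ {a b w} → Rep a w → Rep b w → a ≡ b
  rep-injective {a} {b} r r′ with ℤ.<-cmp a b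
  ... | tri< a<b _ _ = ⊥-elim (≺-irrefl (rep-increasing r r′ a<b))
  ... | tri≈ _ a≡b _ = a≡b
  ... | tri> _ _ b<a = ⊥-elim (≺-irrefl (rep-increasing r′ r b<a))

  Characterised : (ℤ → List ℕ) → Set
  Characterised f = Increasing f × (∀ w → Σ ℤ (λ z → f z ≡ w) ⇔ Img w) × f (+ 0) ≡ w₀

  graph⇒characterised : ∀ f → (∀ n → Rep n (f n)) → Characterised f
  graph⇒characterised f rep =
    (λ m n m<n → rep-increasing (rep m) (rep n) m<n) ,
    (λ w → mk⇔ (λ { (z , refl) → rep-into (rep z) })
               (λ img → let (n , r) = rep-onto img in n , rep-functional (rep n) r)) ,
    rep-functional (rep (+ 0)) rep-0

  -- f n is the representation of its position g n, and g is an increasing surjection fixing 0.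
  characterised⇒graph : ∀ f → Characterised f → ∀ n → Rep n (f n)
  characterised⇒graph f (f-inc , f-img , f0) n =
    subst (λ z → Rep z (f n)) (increasing-surjection-id g g-increasing g-surjective g0 n) (rep-g n)
    where
    position : ∀ n → ∃ λ m → Rep m (f n)
    position n = rep-onto (Equivalence.to (f-img (f n)) (n , refl))
    g : ℤ → ℤ
    g n = proj₁ (position n)
    rep-g : ∀ n → Rep (g n) (f n)
    rep-g n = proj₂ (position n)
    g-increasing : ∀ m n → m ℤ.< n → g m ℤ.< g n
    g-increasing m n m<n with ℤ.<-cmp (g m) (g n)
    ... | tri< gm<gn _ _ = gm<gn
    ... | tri≈ _ gm≡gn _ = ⊥-elim (≺-irrefl (subst (f m ≺_)
            (sym (rep-functional (rep-g m) (subst (λ z → Rep z (f n)) (sym gm≡gn) (rep-g n)))) (f-inc m n m<n)))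
    ... | tri> _ _ gn<gm = ⊥-elim (≺-asym (f-inc m n m<n) (rep-increasing (rep-g n) (rep-g m) gn<gm))
    g-surjective : ∀ z → ∃ λ n → g n ≡ z
    g-surjective z with rep-total z
    ... | w , r with Equivalence.from (f-img w) (rep-into r)
    ... | n , refl = n , rep-injective (rep-g n) r
    g0 : g (+ 0) ≡ + 0
    g0 = rep-injective (subst (Rep (g (+ 0))) f0 (rep-g (+ 0))) rep-0

  graph⇔characterised : ∀ f → (∀ n → Rep n (f n)) ⇔ Characterised f
  graph⇔characterised f = mk⇔ (graph⇒characterised f) (characterised⇒graph f)

-- Iterates of a non-erasing morphism and admissible sequences

module Substitution {k : ℕ} (η : Morphism {k}) (η-nonErasing : ∀ a → 1 ≤ length (η a)) where

  Word : Set
  Word = List (Fin k)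

  onWord-single : ∀ (θ : Morphism {k}) a → onWord θ (a ∷ []) ≡ θ a
  onWord-single θ a = ++-identityʳ (θ a)

  onWord-⊑ : ∀ (θ : Morphism {k}) {a b : Word} → a ⊑ b → onWord θ a ⊑ onWord θ b
  onWord-⊑ θ {a} (z , refl) = onWord θ z , sym (concatMap-++ θ a z)

  length-onWord-∷ʳ : ∀ (θ : Morphism {k}) (v : Word) b →
                     length (onWord θ (v ∷ʳ b)) ≡ length (onWord θ v) + length (θ b)
  length-onWord-∷ʳ θ v b = begin
    length (onWord θ (v ∷ʳ b))                       ≡⟨ cong length (concatMap-++ θ v (b ∷ [])) ⟩
    length (onWord θ v ++ onWord θ (b ∷ []))         ≡⟨ length-++ (onWord θ v) ⟩
    length (onWord θ v) + length (onWord θ (b ∷ [])) ≡⟨ cong (λ w → _ + length w) (onWord-single θ b) ⟩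
    length (onWord θ v) + length (θ b)               ∎
    where open ≡-Reasoning

  ηⁱ : ℕ → Word → Word
  ηⁱ i = onWord (pow η i)

  ηⁱ-zero : ∀ w → ηⁱ 0 w ≡ w
  ηⁱ-zero []      = refl
  ηⁱ-zero (x ∷ w) = cong (x ∷_) (ηⁱ-zero w)

  ηⁱ-suc : ∀ i w → ηⁱ (suc i) w ≡ onWord η (ηⁱ i w)
  ηⁱ-suc i []      = refl
  ηⁱ-suc i (x ∷ w) =
    trans (cong (onWord η (pow η i x) ++_) (ηⁱ-suc i w)) (sym (concatMap-++ η (pow η i x) (ηⁱ i w)))

  pow-+ : ∀ i j a → pow η (i + j) a ≡ ηⁱ i (pow η j a)
  pow-+ zero    j a = sym (ηⁱ-zero _)
  pow-+ (suc i) j a = trans (cong (onWord η) (pow-+ i j a)) (sym (ηⁱ-suc i (pow η j a)))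

  length-ηⁱ-++ : ∀ i (v w : Word) → length (ηⁱ i (v ++ w)) ≡ length (ηⁱ i v) + length (ηⁱ i w)
  length-ηⁱ-++ i v w = trans (cong length (concatMap-++ (pow η i) v w)) (length-++ (ηⁱ i v))

  length-pow≤length-ηⁱ-∷ : ∀ i a w → length (pow η i a) ≤ length (ηⁱ i (a ∷ w))
  length-pow≤length-ηⁱ-∷ i a w = subst (length (pow η i a) ≤_) (sym (length-++ (pow η i a))) (m≤m+n _ _)

  length-onWord-≥ : ∀ (w : Word) → length w ≤ length (onWord η w)
  length-onWord-≥ []      = z≤n
  length-onWord-≥ (x ∷ w) =
    subst (suc (length w) ≤_) (sym (length-++ (η x))) (+-mono-≤ (η-nonErasing x) (length-onWord-≥ w))

  length-pow-pos : ∀ i a → 1 ≤ length (pow η i a)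
  length-pow-pos zero    a = s≤s z≤n
  length-pow-pos (suc i) a = ≤-trans (length-pow-pos i a) (length-onWord-≥ (pow η i a))

  reached : Fin k → Seq {k} → Fin k
  reached x []            = x
  reached x ((_ , a) ∷ _) = a

  admissible-∷⁻ : ∀ {x m a} r → Admissible η x ((m , a) ∷ r) →
                  m ∷ʳ a ⊑ η (reached x r) × Admissible η x r
  admissible-∷⁻ []      p = p , tt
  admissible-∷⁻ (_ ∷ _) p = p

  admissible-∷⁺ : ∀ {x m a} r → m ∷ʳ a ⊑ η (reached x r) → Admissible η x r →
                  Admissible η x ((m , a) ∷ r)
  admissible-∷⁺ []      p _ = p
  admissible-∷⁺ (_ ∷ _) p q = p , q

  valueFrom-suc : ∀ i r → valueFrom η (suc i) r ≡ onWord η (valueFrom η i r)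
  valueFrom-suc i []            = refl
  valueFrom-suc i ((m , a) ∷ r) =
    trans (cong₂ _++_ (valueFrom-suc (suc i) r) (ηⁱ-suc i m))
          (sym (concatMap-++ η (valueFrom η (suc i) r) (ηⁱ i m)))

  valueFrom-ηⁱ : ∀ i r → valueFrom η i r ≡ ηⁱ i (value η r)
  valueFrom-ηⁱ zero    r = sym (ηⁱ-zero _)
  valueFrom-ηⁱ (suc i) r =
    trans (valueFrom-suc i r) (trans (cong (onWord η) (valueFrom-ηⁱ i r)) (sym (ηⁱ-suc i (value η r))))

  value-∷ : ∀ m a r → value η ((m , a) ∷ r) ≡ onWord η (value η r) ++ m
  value-∷ m a r = cong₂ _++_ (valueFrom-suc 0 r) (ηⁱ-zero m)

  length-value-∷ : ∀ m a r → length (value η ((m , a) ∷ r)) ≡ length (onWord η (value η r)) + length m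
  length-value-∷ m a r = trans (cong length (value-∷ m a r)) (length-++ (onWord η (value η r)))

  value-⊑ : ∀ x s → Admissible η x s → value η s ∷ʳ reached x s ⊑ pow η (length s) x
  value-⊑ x []            _  = ⊑-refl _
  value-⊑ x ((m , a) ∷ r) ad with admissible-∷⁻ r ad
  ... | ma⊑ , ad-r = subst (_⊑ pow η (suc (length r)) x) (sym lhs)
    (⊑-trans (++⁺ˡ-⊑ (onWord η (value η r)) (⊑-trans ma⊑ (⊑-++ (η (reached x r)) [])))
             (subst (_⊑ onWord η (pow η (length r) x)) (concatMap-++ η (value η r) (reached x r ∷ []))
                    (onWord-⊑ η (value-⊑ x r ad-r))))
    where
    lhs : value η ((m , a) ∷ r) ∷ʳ a ≡ onWord η (value η r) ++ (m ∷ʳ a)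
    lhs = trans (cong (_∷ʳ a) (value-∷ m a r)) (++-assoc (onWord η (value η r)) m (a ∷ []))

  onWord-position : ∀ (w : Word) n → n < length (onWord η w) → ∃ λ v → ∃ λ b → ∃ λ m → ∃ λ a →
    v ∷ʳ b ⊑ w × m ∷ʳ a ⊑ η b × length (onWord η v) + length m ≡ n
  onWord-position (c ∷ w) n n< with n <? length (η c)
  ... | yes n<ηc with ∷ʳ-⊑-of-length (η c) n n<ηc
  ...   | m , a , ma⊑ , e = [] , c , m , a , (w , refl) , ma⊑ , e
  onWord-position (c ∷ w) n n< | no n≮ηc
    with onWord-position w (n ∸ length (η c))
           (+-cancelˡ-< (length (η c)) _ _ (subst₂ _<_ (sym (m+[n∸m]≡n (≮⇒≥ n≮ηc))) (length-++ (η c)) n<))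
  ... | v , b , m , a , vb⊑ , ma⊑ , e = c ∷ v , b , m , a , ∷⁺-⊑ vb⊑ , ma⊑ , (begin
    length (η c ++ onWord η v) + length m     ≡⟨ cong (_+ length m) (length-++ (η c)) ⟩
    length (η c) + length (onWord η v) + length m ≡⟨ +-assoc (length (η c)) _ _ ⟩
    length (η c) + (length (onWord η v) + length m) ≡⟨ cong (λ z → length (η c) + z) e ⟩
    length (η c) + (n ∸ length (η c))        ≡⟨ m+[n∸m]≡n (≮⇒≥ n≮ηc) ⟩
    n                                        ∎)
    where open ≡-Reasoning

  admissible-exists : ∀ q x n → n < length (pow η q x) →
    ∃ λ s → length s ≡ q × Admissible η x s × length (value η s) ≡ n
  admissible-exists zero    x zero    _ = [] , refl , tt , refl
  admissible-exists zero    x (suc n) (s≤s ())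
  admissible-exists (suc q) x n n< with onWord-position (pow η q x) n n<
  ... | v , b , m , a , vb⊑ , ma⊑ , e with admissible-exists q x (length v) (∷ʳ-⊑-length vb⊑)
  ... | r , refl , ad-r , |r|≡|v| with ∷ʳ-⊑-unique (value-⊑ x r ad-r) vb⊑ |r|≡|v|
  ... | refl , refl = (m , a) ∷ r , refl , admissible-∷⁺ r ma⊑ ad-r , trans (length-value-∷ m a r) e

  length-value-<-∷ : ∀ {x m a m′ a′} r r′ →
    Admissible η x ((m , a) ∷ r) → Admissible η x ((m′ , a′) ∷ r′) →
    length r ≡ length r′ → length (value η r) < length (value η r′) →
    length (value η ((m , a) ∷ r)) < length (value η ((m′ , a′) ∷ r′))
  length-value-<-∷ {x} {m} {a} {m′} {a′} r r′ ad ad′ |r|≡ lt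
    with admissible-∷⁻ r ad | admissible-∷⁻ r′ ad′
  ... | ma⊑ , ad-r | _ , ad-r′ = begin-strict
    length (value η ((m , a) ∷ r))      ≡⟨ length-value-∷ m a r ⟩
    length (onWord η v) + length m      <⟨ +-monoʳ-< (length (onWord η v)) (∷ʳ-⊑-length ma⊑) ⟩
    length (onWord η v) + length (η c)  ≡⟨ length-onWord-∷ʳ η v c ⟨
    length (onWord η (v ∷ʳ c))          ≤⟨ ⊑-length (onWord-⊑ η vc⊑v′) ⟩
    length (onWord η v′)                ≤⟨ m≤m+n _ (length m′) ⟩
    length (onWord η v′) + length m′    ≡⟨ length-value-∷ m′ a′ r′ ⟨
    length (value η ((m′ , a′) ∷ r′))   ∎
    where
    open ≤-Reasoning
    v : Word
    v = value η r
    c : Fin k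
    c = reached x r
    v′ : Word
    v′ = value η r′
    vc⊑v′ : v ∷ʳ c ⊑ v′
    vc⊑v′ = ⊑-common (value-⊑ x r ad-r)
      (subst (λ q → v′ ⊑ pow η q x) (sym |r|≡) (⊑-trans (⊑-++ v′ _) (value-⊑ x r′ ad-r′)))
      (subst (_≤ length v′) (sym (length-∷ʳ v c)) lt)

  admissible-unique : ∀ x s s′ → Admissible η x s → Admissible η x s′ → length s ≡ length s′ →
    length (value η s) ≡ length (value η s′) → s ≡ s′
  admissible-unique x []            []              _  _   _  _  = refl
  admissible-unique x ((m , a) ∷ r) ((m′ , a′) ∷ r′) ad ad′ el ev
    with admissible-∷⁻ r ad | admissible-∷⁻ r′ ad′ | <-cmp (length (value η r)) (length (value η r′))
  ... | _ | _ | tri< lt _ _ = ⊥-elim (<-irrefl ev (length-value-<-∷ r r′ ad ad′ (suc-injective el) lt))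
  ... | _ | _ | tri> _ _ gt = ⊥-elim (<-irrefl (sym ev) (length-value-<-∷ r′ r ad′ ad (sym (suc-injective el)) gt))
  ... | ma⊑ , ad-r | ma⊑′ , ad-r′ | tri≈ _ eq _ with admissible-unique x r r′ ad-r ad-r′ (suc-injective el) eq
  ... | refl with ∷ʳ-⊑-unique ma⊑ ma⊑′
                   (+-cancelˡ-≡ _ _ _ (trans (sym (length-value-∷ m a r)) (trans ev (length-value-∷ m′ a′ r))))
  ... | refl , refl = refl

  digits-∷ : ∀ (m : Word) a r → digits ((m , a) ∷ r) ≡ digits r ∷ʳ length m
  digits-∷ m a r = unfold-reverse (length m) (map (λ ma → length (proj₁ ma)) r)

  length-digits : ∀ (s : Seq {k}) → length (digits s) ≡ length s
  length-digits s = trans (length-reverse (map (λ ma → length (proj₁ ma)) s)) (length-map _ s)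

  admissible-<lex : ∀ x s s′ → Admissible η x s → Admissible η x s′ → length s ≡ length s′ →
    length (value η s) < length (value η s′) → digits s <lex digits s′
  admissible-<lex x ((m , a) ∷ r) ((m′ , a′) ∷ r′) ad ad′ el lt
    with admissible-∷⁻ r ad | admissible-∷⁻ r′ ad′ | <-cmp (length (value η r)) (length (value η r′))
  ... | _ , ad-r | _ , ad-r′ | tri< lt-r _ _ = subst₂ _<lex_ (sym (digits-∷ m a r)) (sym (digits-∷ m′ a′ r′))
    (<lex-++ _ _ (admissible-<lex x r r′ ad-r ad-r′ (suc-injective el) lt-r)
                 (trans (length-digits r) (trans (suc-injective el) (sym (length-digits r′)))))
  ... | _ | _ | tri> _ _ gt-r = ⊥-elim (<-asym lt (length-value-<-∷ r′ r ad′ ad (sym (suc-injective el)) gt-r))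
  ... | _ , ad-r | _ , ad-r′ | tri≈ _ eq _ with admissible-unique x r r′ ad-r ad-r′ (suc-injective el) eq
  ... | refl = subst₂ _<lex_ (sym (digits-∷ m a r)) (sym (digits-∷ m′ a′ r))
    (<lex-∷ʳ (digits r) (+-cancelˡ-< _ _ _ (subst₂ _<_ (length-value-∷ m a r) (length-value-∷ m′ a′ r) lt)))

  digits-injective : ∀ x s s′ → Admissible η x s → Admissible η x s′ → length s ≡ length s′ →
    digits s ≡ digits s′ → s ≡ s′
  digits-injective x s s′ ad ad′ el ed with <-cmp (length (value η s)) (length (value η s′))
  ... | tri< lt _ _ = ⊥-elim (<lex-irrefl (subst (_<lex digits s′) ed (admissible-<lex x s s′ ad ad′ el lt)))
  ... | tri≈ _ eq _ = admissible-unique x s s′ ad ad′ el eq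
  ... | tri> _ _ gt = ⊥-elim (<lex-irrefl (subst (_<lex digits s) (sym ed) (admissible-<lex x s′ s ad′ ad (sym el) gt)))

  reached-++ : ∀ x (l t : Seq {k}) → reached x (l ++ t) ≡ reached (reached x t) l
  reached-++ x []      t = refl
  reached-++ x (_ ∷ l) t = refl

  admissible-++⁻ : ∀ x l t → Admissible η x (l ++ t) → Admissible η x t × Admissible η (reached x t) l
  admissible-++⁻ x []            t ad = ad , tt
  admissible-++⁻ x ((m , a) ∷ l) t ad with admissible-∷⁻ (l ++ t) ad
  ... | ma⊑ , ad′ with admissible-++⁻ x l t ad′
  ... | ad-t , ad-l = ad-t , admissible-∷⁺ l (subst (λ c → m ∷ʳ a ⊑ η c) (reached-++ x l t) ma⊑) ad-l

  admissible-++⁺ : ∀ x l t → Admissible η x t → Admissible η (reached x t) l → Admissible η x (l ++ t)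
  admissible-++⁺ x []            t ad-t _    = ad-t
  admissible-++⁺ x ((m , a) ∷ l) t ad-t ad-l with admissible-∷⁻ l ad-l
  ... | ma⊑ , ad-l′ =
    admissible-∷⁺ (l ++ t) (subst (λ c → m ∷ʳ a ⊑ η c) (sym (reached-++ x l t)) ma⊑)
                  (admissible-++⁺ x l t ad-t ad-l′)

  valueFrom-++ : ∀ i (l t : Seq {k}) → valueFrom η i (l ++ t) ≡ valueFrom η (i + length l) t ++ valueFrom η i l
  valueFrom-++ i []            t = sym (trans (++-identityʳ _) (cong (λ j → valueFrom η j t) (+-identityʳ i)))
  valueFrom-++ i ((m , a) ∷ l) t = begin
    valueFrom η (suc i) (l ++ t) ++ ηⁱ i m
      ≡⟨ cong (_++ ηⁱ i m) (valueFrom-++ (suc i) l t) ⟩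
    (valueFrom η (suc i + length l) t ++ valueFrom η (suc i) l) ++ ηⁱ i m
      ≡⟨ ++-assoc (valueFrom η (suc i + length l) t) _ _ ⟩
    valueFrom η (suc i + length l) t ++ valueFrom η (suc i) l ++ ηⁱ i m
      ≡⟨ cong (λ j → valueFrom η j t ++ valueFrom η (suc i) l ++ ηⁱ i m) (sym (+-suc i (length l))) ⟩
    valueFrom η (i + suc (length l)) t ++ valueFrom η (suc i) l ++ ηⁱ i m ∎
    where open ≡-Reasoning

  length-value-++ : ∀ (l t : Seq {k}) →
    length (value η (l ++ t)) ≡ length (ηⁱ (length l) (value η t)) + length (value η l)
  length-value-++ l t = begin
    length (value η (l ++ t))                                   ≡⟨ cong length (valueFrom-++ 0 l t) ⟩
    length (valueFrom η (length l) t ++ value η l)              ≡⟨ length-++ (valueFrom η (length l) t) ⟩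
    length (valueFrom η (length l) t) + length (value η l)  ≡⟨ cong (λ w → length w + _) (valueFrom-ηⁱ (length l) t) ⟩
    length (ηⁱ (length l) (value η t)) + length (value η l)     ∎
    where open ≡-Reasoning

  digits-++ : ∀ (l t : Seq {k}) → digits (l ++ t) ≡ digits t ++ digits l
  digits-++ l t = trans (cong reverse (map-++ (λ ma → length (proj₁ ma)) l t))
                        (reverse-++ (map (λ ma → length (proj₁ ma)) l) _)

  length-value-++-bounds : ∀ x (low top : Seq {k}) → Admissible η x (low ++ top) →
      length (ηⁱ (length low) (value η top)) ≤ length (value η (low ++ top))
    × length (value η (low ++ top)) < length (ηⁱ (length low) (value η top ∷ʳ reached x top))
  length-value-++-bounds x low top ad with admissible-++⁻ x low top ad
  ... | _ , ad-low = subst (length (ηⁱ i vt) ≤_) (sym (length-value-++ low top)) (m≤m+n _ _) , (begin-strict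
    length (value η (low ++ top))                  ≡⟨ length-value-++ low top ⟩
    length (ηⁱ i vt) + length (value η low)        <⟨ +-monoʳ-< _ (∷ʳ-⊑-length (value-⊑ c low ad-low)) ⟩
    length (ηⁱ i vt) + length (pow η i c)          ≡⟨ cong (λ w → length (ηⁱ i vt) + length w) (onWord-single (pow η i) c) ⟨
    length (ηⁱ i vt) + length (ηⁱ i (c ∷ []))      ≡⟨ length-ηⁱ-++ i vt (c ∷ []) ⟨
    length (ηⁱ i (vt ∷ʳ c))                        ∎)
    where
    open ≤-Reasoning
    i : ℕ
    i = length low
    vt : Word
    vt = value η top
    c : Fin k
    c = reached x top

  onWord-≡[] : ∀ {w : Word} → onWord η w ≡ [] → w ≡ []
  onWord-≡[] {[]}    _ = refl
  onWord-≡[] {x ∷ w} e with η x | η-nonErasing x | e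
  ... | _ ∷ _ | _ | ()

  Silent : Seq {k} → Set
  Silent s = concat (map proj₁ s) ≡ []

  silent⇔value≡[] : ∀ s → Silent s ⇔ value η s ≡ []
  silent⇔value≡[] []            = mk⇔ (λ _ → refl) (λ _ → refl)
  silent⇔value≡[] ((m , a) ∷ r) = mk⇔ to from
    where
    to : Silent ((m , a) ∷ r) → value η ((m , a) ∷ r) ≡ []
    to e with ++-conicalˡ m _ e
    ... | refl = trans (value-∷ [] a r)
      (trans (++-identityʳ _) (cong (onWord η) (Equivalence.to (silent⇔value≡[] r) e)))
    from : value η ((m , a) ∷ r) ≡ [] → Silent ((m , a) ∷ r)
    from e with ++-conicalˡ _ m (trans (sym (value-∷ m a r)) e) | ++-conicalʳ _ m (trans (sym (value-∷ m a r)) e)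
    ... | ηv≡[] | refl = Equivalence.from (silent⇔value≡[] r) (onWord-≡[] ηv≡[])

  silent⇔digits≡0s : ∀ s → Silent s ⇔ digits s ≡ replicate (length s) 0
  silent⇔digits≡0s []            = mk⇔ (λ _ → refl) (λ _ → refl)
  silent⇔digits≡0s ((m , a) ∷ r) = mk⇔ to from
    where
    zeros-∷ʳ : ∀ n → replicate (suc n) 0 ≡ replicate n 0 ∷ʳ 0
    zeros-∷ʳ zero    = refl
    zeros-∷ʳ (suc n) = cong (0 ∷_) (zeros-∷ʳ n)
    to : Silent ((m , a) ∷ r) → digits ((m , a) ∷ r) ≡ replicate (suc (length r)) 0
    to e with ++-conicalˡ m _ e
    ... | refl = trans (digits-∷ [] a r)
      (trans (cong (_∷ʳ 0) (Equivalence.to (silent⇔digits≡0s r) e)) (sym (zeros-∷ʳ (length r))))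
    from : digits ((m , a) ∷ r) ≡ replicate (suc (length r)) 0 → Silent ((m , a) ∷ r)
    from e with ∷ʳ-injective (digits r) (replicate (length r) 0)
                  (trans (sym (digits-∷ m a r)) (trans e (zeros-∷ʳ (length r))))
    ... | e-r , |m|≡0 = cong₂ _++_ (length≡0⇒[] |m|≡0) (Equivalence.from (silent⇔digits≡0s r) e-r)

  nth-∷ʳ-⊑ : ∀ {m : Word} {a w} → m ∷ʳ a ⊑ w → nth {k} w (length m) ≡ just a
  nth-∷ʳ-⊑ {[]}    (_ , refl) = refl
  nth-∷ʳ-⊑ {_ ∷ m} (_ , refl) = nth-∷ʳ-⊑ {m} (_ , refl)

  nth⇒∷ʳ-⊑ : ∀ (w : Word) n {a} → nth {k} w n ≡ just a → ∃ λ m → m ∷ʳ a ⊑ w × length m ≡ n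
  nth⇒∷ʳ-⊑ (x ∷ w) zero    refl = [] , (w , refl) , refl
  nth⇒∷ʳ-⊑ (x ∷ w) (suc n) e with nth⇒∷ʳ-⊑ w n e
  ... | m , ma⊑ , refl = x ∷ m , ∷⁺-⊑ ma⊑ , refl

  module Runs (u : ℤ → Fin k) where

    δ*-++ : ∀ q xs ys {q′} → δ* η u q xs ≡ just q′ → δ* η u q (xs ++ ys) ≡ δ* η u q′ ys
    δ*-++ q []       ys refl = refl
    δ*-++ q (i ∷ xs) ys e with δ η u q i
    ... | just q″ = δ*-++ q″ xs ys e
    ... | nothing = case e of λ ()

    admissible⇒run : ∀ x s → Admissible η x s → δ* η u (st x) (digits s) ≡ just (st (reached x s))
    admissible⇒run x []            _  = refl
    admissible⇒run x ((m , a) ∷ r) ad with admissible-∷⁻ r ad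
    ... | ma⊑ , ad-r = begin
      δ* η u (st x) (digits ((m , a) ∷ r))        ≡⟨ cong (δ* η u (st x)) (digits-∷ m a r) ⟩
      δ* η u (st x) (digits r ++ length m ∷ [])   ≡⟨ δ*-++ (st x) (digits r) _ (admissible⇒run x r ad-r) ⟩
      δ* η u (st (reached x r)) (length m ∷ [])   ≡⟨ lastStep ⟩
      just (st a)                                 ∎
      where
      open ≡-Reasoning
      lastStep : δ* η u (st (reached x r)) (length m ∷ []) ≡ just (st a)
      lastStep rewrite nth-∷ʳ-⊑ ma⊑ = refl

    run⇒admissible : ∀ x ds {c} → δ* η u (st x) ds ≡ just (st c) → ∃ λ s → Admissible η x s × digits s ≡ ds
    run⇒admissible x []       _ = [] , tt , refl
    run⇒admissible x (d ∷ ds) e with nth {k} (η x) d in eq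
    ... | just b with run⇒admissible b ds e | nth⇒∷ʳ-⊑ (η x) d eq
    ... | r , ad-r , refl | m , mb⊑ , refl =
      r ++ (m , b) ∷ [] , admissible-++⁺ x r ((m , b) ∷ []) mb⊑ ad-r , digits-++ r ((m , b) ∷ [])

-[m]+n≡-[1+o]⇔n+[1+o]≡m : ∀ m n o → (- (+ m) ℤ.+ + n ≡ -[1+ o ]) ⇔ (n + suc o ≡ m)
-[m]+n≡-[1+o]⇔n+[1+o]≡m m n o = mk⇔ to from
  where
  to : - (+ m) ℤ.+ + n ≡ -[1+ o ] → n + suc o ≡ m
  to e with n <? m
  ... | yes n<m = trans (cong (λ z → n + z) (sym (ℤ.+-injective (ℤ.neg-injective m∸n≡)))) (m+[n∸m]≡n (<⇒≤ n<m))
    where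
    m∸n≡ : - (+ (m ∸ n)) ≡ - (+ suc o)
    m∸n≡ = trans (sym (ℤ.⊖-< n<m)) (trans (sym (ℤ.-m+n≡n⊖m m n)) e)
  ... | no n≮m with trans (sym (ℤ.⊖-≥ (≮⇒≥ n≮m))) (trans (sym (ℤ.-m+n≡n⊖m m n)) e)
  ... | ()
  from : n + suc o ≡ m → - (+ m) ℤ.+ + n ≡ -[1+ o ]
  from refl = begin
    - (+ (n + suc o)) ℤ.+ + n  ≡⟨ ℤ.-m+n≡n⊖m (n + suc o) n ⟩
    n ℤ.⊖ (n + suc o)          ≡⟨ cong (ℤ._⊖ (n + suc o)) (+-identityʳ n) ⟨
    (n + 0) ℤ.⊖ (n + suc o)    ≡⟨ ℤ.+-cancelˡ-⊖ n 0 (suc o) ⟩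
    -[1+ o ]                   ∎
    where open ≡-Reasoning

module Segments {k : ℕ} (u : ℤ → Fin k) where

  length-segment : ∀ a n → length (segment u a n) ≡ n
  length-segment a n = trans (length-map _ (upTo n)) (length-upTo n)

  segment-suc : ∀ a n → segment u a (suc n) ≡ u a ∷ segment u (a ℤ.+ + 1) n
  segment-suc a n = cong₂ _∷_ (cong u (ℤ.+-identityʳ a)) (begin
    map (λ i → u (a ℤ.+ + i)) (applyUpTo suc n)        ≡⟨ cong (map _) (map-upTo suc n) ⟨
    map (λ i → u (a ℤ.+ + i)) (map suc (upTo n))       ≡⟨ map-∘ (upTo n) ⟨
    map (λ i → u (a ℤ.+ + suc i)) (upTo n)             ≡⟨ map-cong shift (upTo n) ⟩
    map (λ i → u (a ℤ.+ + 1 ℤ.+ + i)) (upTo n)         ∎)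
    where
    open ≡-Reasoning
    shift : ∀ i → u (a ℤ.+ + suc i) ≡ u (a ℤ.+ + 1 ℤ.+ + i)
    shift i = cong u (trans (cong (λ z → a ℤ.+ z) (ℤ.pos-+ 1 i)) (sym (ℤ.+-assoc a (+ 1) (+ i))))

  segment-+ : ∀ a m n → segment u a (m + n) ≡ segment u a m ++ segment u (a ℤ.+ + m) n
  segment-+ a zero    n = cong (λ b → segment u b n) (sym (ℤ.+-identityʳ a))
  segment-+ a (suc m) n = begin
    segment u a (suc m + n)                                       ≡⟨ segment-suc a (m + n) ⟩
    u a ∷ segment u (a ℤ.+ + 1) (m + n)                           ≡⟨ cong (u a ∷_) (segment-+ (a ℤ.+ + 1) m n) ⟩
    u a ∷ segment u (a ℤ.+ + 1) m ++ segment u (a ℤ.+ + 1 ℤ.+ + m) n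
      ≡⟨ cong₂ (λ w b → w ++ segment u b n) (sym (segment-suc a m)) shift ⟩
    segment u a (suc m) ++ segment u (a ℤ.+ + suc m) n              ∎
    where
    open ≡-Reasoning
    shift : a ℤ.+ + 1 ℤ.+ + m ≡ a ℤ.+ + suc m
    shift = trans (ℤ.+-assoc a (+ 1) (+ m)) (cong (λ z → a ℤ.+ z) (sym (ℤ.pos-+ 1 m)))

  segment-∷ʳ : ∀ n → segment u -[1+ n ] (suc n) ≡ segment u -[1+ n ] n ∷ʳ u -[1+ 0 ]
  segment-∷ʳ n = begin
    segment u -[1+ n ] (suc n)                                     ≡⟨ cong (segment u -[1+ n ]) (+-comm 1 n) ⟩
    segment u -[1+ n ] (n + 1)                                     ≡⟨ segment-+ -[1+ n ] n 1 ⟩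
    segment u -[1+ n ] n ++ u (-[1+ n ] ℤ.+ + n ℤ.+ + 0) ∷ []       ≡⟨ cong (λ z → segment u -[1+ n ] n ∷ʳ u z) last ⟩
    segment u -[1+ n ] n ∷ʳ u -[1+ 0 ]                              ∎
    where
    open ≡-Reasoning
    last : -[1+ n ] ℤ.+ + n ℤ.+ + 0 ≡ -[1+ 0 ]
    last = trans (ℤ.+-identityʳ _) (Equivalence.from (-[m]+n≡-[1+o]⇔n+[1+o]≡m (suc n) n 0) (+-comm n 1))

  segment-head : ∀ w → 1 ≤ length w → segment u (+ 0) (length w) ≡ w → ∃ λ t → w ≡ u (+ 0) ∷ t
  segment-head (c ∷ t) _ e = t , cong (_∷ t) (proj₁ (∷-injective (trans (sym e) (segment-suc (+ 0) (length t)))))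

  segment-last : ∀ w → 1 ≤ length w → segment u (- (+ length w)) (length w) ≡ w →
                 ∃ λ X → w ≡ X ∷ʳ u -[1+ 0 ]
  segment-last (c ∷ t) _ e = segment u -[1+ length t ] (length t) , trans (sym e) (segment-∷ʳ (length t))

  ⊑-segment : ∀ a n (v : List (Fin k)) → v ⊑ segment u a n → segment u a (length v) ≡ v
  ⊑-segment a n v v⊑ = ⊑-common-≡ initial⊑ v⊑ (length-segment a (length v))
    where
    |v|≤n : length v ≤ n
    |v|≤n = ≤-trans (⊑-length v⊑) (≤-reflexive (length-segment a n))
    initial⊑ : segment u a (length v) ⊑ segment u a n
    initial⊑ = subst (λ m → segment u a (length v) ⊑ segment u a m) (m+[n∸m]≡n |v|≤n)
      (subst (segment u a (length v) ⊑_) (sym (segment-+ a (length v) (n ∸ length v))) (⊑-++ _ _))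

<-balance : ∀ {a b c d} → a + b ≡ c + d → a < c → d < b
<-balance e a<c = ≰⇒> (λ b≤d → <-irrefl e (+-mono-<-≤ a<c b≤d))

monotone-by-steps : ∀ (L : ℕ → ℕ) → (∀ j → L j ≤ L (suc j)) → ∀ {i j} → i ≤ j → L i ≤ L j
monotone-by-steps L step {zero}  {zero}  _       = ≤-refl
monotone-by-steps L step {zero}  {suc j} _       = ≤-trans (monotone-by-steps L step {0} {j} z≤n) (step j)
monotone-by-steps L step {suc i} {suc j} (s≤s l) = monotone-by-steps (λ j → L (suc j)) (λ j → step (suc j)) l

level-exists : ∀ (L : ℕ → ℕ) n J → L 0 ≤ n → n < L J → ∃ λ j → L j ≤ n × n < L (suc j)
level-exists L n zero    L0≤n n<L0 = ⊥-elim (<-irrefl refl (<-≤-trans n<L0 L0≤n))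
level-exists L n (suc J) L0≤n n<L with n <? L J
... | yes n<LJ = level-exists L n J L0≤n n<LJ
... | no  n≮LJ = J , ≮⇒≥ n≮LJ , n<L

level-≤ : ∀ {L : ℕ → ℕ} → (∀ {i j} → i ≤ j → L i ≤ L j) →
  ∀ {j j′ n n′} → L j ≤ n → n′ < L (suc j′) → n ≤ n′ → j ≤ j′
level-≤ L-mono Lj≤n n′<L n≤n′ =
  ≮⇒≥ (λ j′<j → <-irrefl refl (<-≤-trans n′<L (≤-trans (L-mono j′<j) (≤-trans Lj≤n n≤n′))))

-- The numeration system of a periodic point

module PeriodicPoint {k : ℕ} (η : Morphism {k}) (η-nonErasing : ∀ a → 1 ≤ length (η a))
  (u : ℤ → Fin k) (p′ : ℕ) (fixed : FixedBy η (suc p′) u)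
  (u₀-growing : Growing η (u (+ 0))) (u₋₁-growing : Growing η (u -[1+ 0 ])) where

  open Substitution η η-nonErasing
  open Segments u
  open Runs u

  p : ℕ
  p = suc p′

  u₀ u₋₁ : Fin k
  u₀  = u (+ 0)
  u₋₁ = u -[1+ 0 ]

  L⁺ L⁻ : ℕ → ℕ
  L⁺ j = length (pow η (j * p) u₀)
  L⁻ j = length (pow η (j * p) u₋₁)

  prefix-fixed : ∀ j → segment u (+ 0) (L⁺ j) ≡ pow η (j * p) u₀
  prefix-fixed zero    = refl
  prefix-fixed (suc j) = subst (λ w → segment u (+ 0) (length w) ≡ w)
    (trans (cong (ηⁱ p) (prefix-fixed j)) (sym (pow-+ p (j * p) u₀))) (proj₁ (fixed (L⁺ j)))

  suffix-fixed : ∀ j → segment u (- (+ L⁻ j)) (L⁻ j) ≡ pow η (j * p) u₋₁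
  suffix-fixed zero    = refl
  suffix-fixed (suc j) = subst (λ w → segment u (- (+ length w)) (length w) ≡ w)
    (trans (cong (ηⁱ p) (suffix-fixed j)) (sym (pow-+ p (j * p) u₋₁))) (proj₂ (fixed (L⁻ j)))

  pow-1*p : ∀ a → pow η (1 * p) a ≡ pow η p a
  pow-1*p a = cong (λ q → pow η q a) (*-identityˡ p)

  ηᵖu₀-head : ∃ λ t → pow η p u₀ ≡ u₀ ∷ t
  ηᵖu₀-head = segment-head (pow η p u₀) (length-pow-pos p u₀)
    (subst (λ w → segment u (+ 0) (length w) ≡ w) (pow-1*p u₀) (prefix-fixed 1))

  ηᵖu₋₁-last : ∃ λ X → pow η p u₋₁ ≡ X ∷ʳ u₋₁
  ηᵖu₋₁-last = segment-last (pow η p u₋₁) (length-pow-pos p u₋₁)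
    (subst (λ w → segment u (- (+ length w)) (length w) ≡ w) (pow-1*p u₋₁) (suffix-fixed 1))

  pow-[1+j]p : ∀ j a → pow η (suc j * p) a ≡ ηⁱ (j * p) (pow η p a)
  pow-[1+j]p j a = trans (cong (λ q → pow η q a) (+-comm p (j * p))) (pow-+ (j * p) p a)

  X⁻ : Word
  X⁻ = proj₁ ηᵖu₋₁-last

  D : ℕ → ℕ
  D j = length (ηⁱ (j * p) X⁻)

  L⁻-suc : ∀ j → L⁻ (suc j) ≡ D j + L⁻ j
  L⁻-suc j = begin
    length (pow η (suc j * p) u₋₁)               ≡⟨ cong length (pow-[1+j]p j u₋₁) ⟩
    length (ηⁱ (j * p) (pow η p u₋₁))    ≡⟨ cong (λ w → length (ηⁱ (j * p) w)) (proj₂ ηᵖu₋₁-last) ⟩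
    length (ηⁱ (j * p) (X⁻ ∷ʳ u₋₁))              ≡⟨ length-ηⁱ-++ (j * p) X⁻ (u₋₁ ∷ []) ⟩
    D j + length (ηⁱ (j * p) (u₋₁ ∷ [])) ≡⟨ cong (λ w → D j + length w) (onWord-single (pow η (j * p)) u₋₁) ⟩
    D j + L⁻ j                                   ∎
    where open ≡-Reasoning

  L⁺-mono : ∀ {i j} → i ≤ j → L⁺ i ≤ L⁺ j
  L⁺-mono = monotone-by-steps L⁺ λ j → subst (L⁺ j ≤_)
    (sym (cong length (trans (pow-[1+j]p j u₀) (cong (ηⁱ (j * p)) (proj₂ ηᵖu₀-head)))))
    (length-pow≤length-ηⁱ-∷ (j * p) u₀ (proj₁ ηᵖu₀-head))

  L⁻-mono : ∀ {i j} → i ≤ j → L⁻ i ≤ L⁻ j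
  L⁻-mono = monotone-by-steps L⁻ λ j → subst (L⁻ j ≤_) (sym (L⁻-suc j)) (m≤n+m _ _)

  -- a top block reading all of η^p(u₋₁), as W_max does
  Exhaustive : Seq {k} → Set
  Exhaustive t = value η t ∷ʳ reached u₋₁ t ≡ pow η p u₋₁

  module _ (j : ℕ) (s : Seq {k}) (|s| : length s ≡ suc j * p) where

    private
      c : ℕ
      c = length s ∸ p
      low : Seq {k}
      low = take c s

      c≡jp : c ≡ j * p
      c≡jp = trans (cong (_∸ p) |s|) (m+n∸m≡n p (j * p))

    length-low : length low ≡ j * p
    length-low = trans (length-take c s) (trans (m≤n⇒m⊓n≡m (m∸n≤m (length s) p)) c≡jp)

    length-top : length (topBlock p s) ≡ p
    length-top = trans (length-drop c s) (trans (cong₂ _∸_ |s| c≡jp) (m+n∸n≡m p (j * p)))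

    admissible-top : ∀ x → Admissible η x s → Admissible η x (topBlock p s)
    admissible-top x ad =
      proj₁ (admissible-++⁻ x low (topBlock p s) (subst (Admissible η x) (sym (take++drop≡id c s)) ad))

    digits-blocks : digits s ≡ digits (topBlock p s) ++ digits low
    digits-blocks = trans (cong digits (sym (take++drop≡id c s))) (digits-++ low (topBlock p s))

    length-digits-top : length (digits (topBlock p s)) ≡ p
    length-digits-top = trans (length-digits (topBlock p s)) length-top

    firstLetter-top : ∀ x → firstLetter (topBlock p s) ≡ just (reached x (topBlock p s))
    firstLetter-top x with topBlock p s | length-top
    ... | _ ∷ _ | _ = refl

    value-bounds : ∀ x → Admissible η x s →
        length (ηⁱ (j * p) (value η (topBlock p s))) ≤ length (value η s)
      × length (value η s) < length (ηⁱ (j * p) (value η (topBlock p s) ∷ʳ reached x (topBlock p s)))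
    value-bounds x ad = subst (λ i → Bounds i s) length-low
      (subst (Bounds (length low)) (take++drop≡id c s)
        (length-value-++-bounds x low (topBlock p s) (subst (Admissible η x) (sym (take++drop≡id c s)) ad)))
      where
      Bounds : ℕ → Seq {k} → Set
      Bounds i t = length (ηⁱ i (value η (topBlock p s))) ≤ length (value η t)
                 × length (value η t) < length (ηⁱ i (value η (topBlock p s) ∷ʳ reached x (topBlock p s)))

    value-top-⊑ : ∀ x → Admissible η x s → value η (topBlock p s) ∷ʳ reached x (topBlock p s) ⊑ pow η p x
    value-top-⊑ x ad = subst (λ q → value η (topBlock p s) ∷ʳ reached x (topBlock p s) ⊑ pow η q x) length-top
                             (value-⊑ x (topBlock p s) (admissible-top x ad))

    L⁺-≤-value : Admissible η u₀ s → ¬ Silent (topBlock p s) → L⁺ j ≤ length (value η s)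
    L⁺-≤-value ad loud with value η (topBlock p s) in ev
    ... | []    = ⊥-elim (loud (Equivalence.from (silent⇔value≡[] (topBlock p s)) ev))
    ... | c ∷ v
      with ∷⁻-⊑ (subst₂ _⊑_ (cong (_∷ʳ reached u₀ (topBlock p s)) ev) (proj₂ ηᵖu₀-head) (value-top-⊑ u₀ ad))
    ... | refl , _ = begin
      L⁺ j                                          ≤⟨ length-pow≤length-ηⁱ-∷ (j * p) u₀ v ⟩
      length (ηⁱ (j * p) (u₀ ∷ v))                  ≡⟨ cong (λ w → length (ηⁱ (j * p) w)) ev ⟨
      length (ηⁱ (j * p) (value η (topBlock p s)))  ≤⟨ proj₁ (value-bounds u₀ ad) ⟩
      length (value η s)                            ∎
      where open ≤-Reasoning

    value-<-L⁺ : Admissible η u₀ s → Silent (topBlock p s) → length (value η s) < L⁺ j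
    value-<-L⁺ ad silent = begin-strict
      length (value η s)                           <⟨ proj₂ (value-bounds u₀ ad) ⟩
      length (ηⁱ (j * p) (vt ∷ʳ a))                ≡⟨ cong (λ w → length (ηⁱ (j * p) (w ∷ʳ a))) vt≡[] ⟩
      length (ηⁱ (j * p) (a ∷ []))                 ≡⟨ cong (λ b → length (ηⁱ (j * p) (b ∷ []))) a≡u₀ ⟩
      length (ηⁱ (j * p) (u₀ ∷ []))                ≡⟨ cong length (onWord-single (pow η (j * p)) u₀) ⟩
      L⁺ j                                         ∎
      where
      open ≤-Reasoning
      vt : Word
      vt = value η (topBlock p s)
      a : Fin k
      a = reached u₀ (topBlock p s)
      vt≡[] : vt ≡ []
      vt≡[] = Equivalence.to (silent⇔value≡[] (topBlock p s)) silent
      a≡u₀ : a ≡ u₀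
      a≡u₀ = proj₁ (∷⁻-⊑ (subst₂ _⊑_ (cong (_∷ʳ a) vt≡[]) (proj₂ ηᵖu₀-head) (value-top-⊑ u₀ ad)))

    D-≤-value : Admissible η u₋₁ s → Exhaustive (topBlock p s) → D j ≤ length (value η s)
    D-≤-value ad exh =
      subst (λ w → length (ηⁱ (j * p) w) ≤ length (value η s)) vt≡X⁻ (proj₁ (value-bounds u₋₁ ad))
      where
      vt≡X⁻ : value η (topBlock p s) ≡ X⁻
      vt≡X⁻ = proj₁ (∷ʳ-injective _ _ (trans exh (proj₂ ηᵖu₋₁-last)))

    value-<-D : Admissible η u₋₁ s → ¬ Exhaustive (topBlock p s) → length (value η s) < D j
    value-<-D ad not-exh = begin-strict
      length (value η s)             <⟨ proj₂ (value-bounds u₋₁ ad) ⟩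
      length (ηⁱ (j * p) (vt ∷ʳ a))  ≤⟨ ⊑-length (onWord-⊑ (pow η (j * p)) vta⊑X⁻) ⟩
      D j                            ∎
      where
      open ≤-Reasoning
      vt : Word
      vt = value η (topBlock p s)
      a : Fin k
      a = reached u₋₁ (topBlock p s)
      vta⊑X⁻ : vt ∷ʳ a ⊑ X⁻
      vta⊑X⁻ = ⊑-∷ʳ⁻ (subst (vt ∷ʳ a ⊑_) (proj₂ ηᵖu₋₁-last) (value-top-⊑ u₋₁ ad))
                     (λ e → not-exh (trans e (sym (proj₂ ηᵖu₋₁-last))))

    digits-top-⊑ : digits (topBlock p s) ⊑ digits s
    digits-top-⊑ = subst (digits (topBlock p s) ⊑_) (sym (digits-blocks)) (⊑-++ _ _)

    ⊑-digits⇒top : ∀ {W} → length W ≡ p → W ⊑ digits s → W ≡ digits (topBlock p s)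
    ⊑-digits⇒top |W| W⊑ = ⊑-common-≡ W⊑ digits-top-⊑ (trans |W| (sym (length-digits-top)))

    silent-top⇔zeros⊑ : Silent (topBlock p s) ⇔ replicate p 0 ⊑ digits s
    silent-top⇔zeros⊑ = mk⇔
      (λ silent → subst (_⊑ digits s) (trans (Equivalence.to (silent⇔digits≡0s (topBlock p s)) silent)
                                           (cong (λ q → replicate q 0) (length-top)))
                        digits-top-⊑)
      (λ zeros⊑ → Equivalence.from (silent⇔digits≡0s (topBlock p s))
        (trans (sym (⊑-digits⇒top (length-replicate p) zeros⊑)) (cong (λ q → replicate q 0) (sym (length-top)))))

    exhaustive-top⇔Wmax⊑ : Admissible η u₋₁ s →
                           Exhaustive (topBlock p s) ⇔ (∃ λ W → IsWmax η u p W × W ⊑ digits s)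
    exhaustive-top⇔Wmax⊑ ad = mk⇔ to from
      where
      top : Seq {k}
      top = topBlock p s
      a : Fin k
      a = reached u₋₁ top
      to : Exhaustive top → ∃ λ W → IsWmax η u p W × W ⊑ digits s
      to exh = digits top ,
        (top , length-top , admissible-top u₋₁ ad ,
         cong (_∸ 1) (trans (sym (length-∷ʳ (value η top) a)) (cong length exh)) , refl) ,
        digits-top-⊑
      from : (∃ λ W → IsWmax η u p W × W ⊑ digits s) → Exhaustive top
      from (W , (sW , |sW| , ad-sW , |v|≡ , refl) , W⊑) = ⊑-length-≡ (value-top-⊑ u₋₁ ad) (begin
        length (value η top ∷ʳ a)          ≡⟨ length-∷ʳ (value η top) a ⟩
        suc (length (value η top))         ≡⟨ cong (λ t → suc (length (value η t))) sW≡top ⟨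
        suc (length (value η sW))          ≡⟨ cong suc |v|≡ ⟩
        suc (length (pow η p u₋₁) ∸ 1)     ≡⟨ m+[n∸m]≡n (length-pow-pos p u₋₁) ⟩
        length (pow η p u₋₁)               ∎)
        where
        open ≡-Reasoning
        sW≡top : sW ≡ top
        sW≡top = digits-injective u₋₁ sW top ad-sW (admissible-top u₋₁ ad) (trans |sW| (sym (length-top)))
                   (⊑-digits⇒top (trans (length-digits sW) |sW|) W⊑)

  value-in-prefix : ∀ j s → length s ≡ j * p → Admissible η u₀ s →
    segment u (+ 0) (length (value η s)) ≡ value η s
  value-in-prefix j s |s| ad = ⊑-segment (+ 0) (L⁺ j) (value η s)
    (subst (value η s ⊑_) (sym (prefix-fixed j))
      (subst (λ q → value η s ⊑ pow η q u₀) |s| (⊑-trans (⊑-++ (value η s) _) (value-⊑ u₀ s ad))))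

  value-in-suffix : ∀ j s → length s ≡ j * p → Admissible η u₋₁ s →
    segment u (- (+ length (pow η (length s) u₋₁))) (length (value η s)) ≡ value η s
  value-in-suffix j s |s| ad rewrite |s| = ⊑-segment (- (+ L⁻ j)) (L⁻ j) (value η s)
    (subst (value η s ⊑_) (sym (suffix-fixed j))
      (subst (λ q → value η s ⊑ pow η q u₋₁) |s| (⊑-trans (⊑-++ (value η s) _) (value-⊑ u₋₁ s ad))))

  record RepPosView (n : ℕ) (w : List ℕ) : Set where
    field
      level        : ℕ
      seq          : Seq {k}
      length-seq   : length seq ≡ suc level * p
      admissible   : Admissible η u₀ seq
      length-value : length (value η seq) ≡ n
      lower        : L⁺ level ≤ n
      upper        : n < L⁺ (suc level)
      word         : w ≡ 0 ∷ digits seq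

  repPosView : ∀ {n w} → RepPos η u p n w → RepPosView n w
  repPosView {n} (j , s , |s| , ad , loud , seg≡ , refl) = record
    { level = j ; seq = s ; length-seq = |s| ; admissible = ad ; length-value = |v|≡n
    ; lower = subst (L⁺ j ≤_) |v|≡n (L⁺-≤-value j s |s| ad loud)
    ; upper = subst (λ i → i < L⁺ (suc j)) |v|≡n
                (subst (λ q → length (value η s) < length (pow η q u₀)) |s| (∷ʳ-⊑-length (value-⊑ u₀ s ad)))
    ; word = refl }
    where
    |v|≡n : length (value η s) ≡ n
    |v|≡n = trans (cong length (sym seg≡)) (length-segment (+ 0) n)

  length-digits-seq : ∀ j (s : Seq {k}) → length s ≡ suc j * p → length (digits s) ≡ suc j * p
  length-digits-seq j s |s| = trans (length-digits s) |s|

  module _ {n n′ w w′} (V : RepPosView n w) (V′ : RepPosView n′ w′) where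
    private
      module V = RepPosView V
      module V′ = RepPosView V′

    level⁺-≤ : n ≤ n′ → V.level ≤ V′.level
    level⁺-≤ = level-≤ L⁺-mono V.lower V′.upper

    repPos-functional : n ≡ n′ → w ≡ w′
    repPos-functional refl with ≤-antisym (level⁺-≤ ≤-refl) (level-≤ L⁺-mono V′.lower V.upper ≤-refl)
    ... | refl = begin
      w                 ≡⟨ V.word ⟩
      0 ∷ digits V.seq  ≡⟨ cong (λ s → 0 ∷ digits s) same-seq ⟩
      0 ∷ digits V′.seq ≡⟨ V′.word ⟨
      w′                ∎
      where
      open ≡-Reasoning
      same-seq : V.seq ≡ V′.seq
      same-seq = admissible-unique u₀ V.seq V′.seq V.admissible V′.admissible
        (trans V.length-seq (sym V′.length-seq)) (trans V.length-value (sym V′.length-value))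

    repPos-increasing : n < n′ → w ≺ w′
    repPos-increasing n<n′ rewrite V.word | V′.word with m≤n⇒m<n∨m≡n (level⁺-≤ (<⇒≤ n<n′))
    ... | inj₁ j<j′ = pos<pos _ _ (inj₁ (s≤s (subst₂ _<_
            (sym (length-digits-seq V.level V.seq V.length-seq)) (sym (length-digits-seq V′.level V′.seq V′.length-seq))
            (*-monoˡ-< p (s≤s j<j′)))))
    ... | inj₂ refl = pos<pos _ _ (inj₂ (cong suc (trans (length-digits V.seq) (trans V.length-seq
            (trans (sym V′.length-seq) (sym (length-digits V′.seq))))) ,
          there (admissible-<lex u₀ V.seq V′.seq V.admissible V′.admissible (trans V.length-seq (sym V′.length-seq))
                   (subst₂ _<_ (sym V.length-value) (sym V′.length-value) n<n′))))

  record RepNegView (b : ℕ) (w : List ℕ) : Set where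
    field
      level          : ℕ
      seq            : Seq {k}
      length-seq     : length seq ≡ suc level * p
      admissible     : Admissible η u₋₁ seq
      not-exhaustive : ¬ Exhaustive (topBlock p seq)
      length-value   : length (value η seq) + suc b ≡ L⁻ (suc level)
      lower          : L⁻ level ≤ b
      upper          : b < L⁻ (suc level)
      word           : w ≡ 1 ∷ digits seq

  repNegView : ∀ {b w} → RepNeg η u p -[1+ b ] w → RepNegView b w
  repNegView {b} (j , s , |s| , ad , (a , first≡ , not-exh) , (len , pos≡ , seg≡) , refl) = record
    { level = j ; seq = s ; length-seq = |s| ; admissible = ad ; not-exhaustive = not-exh′
    ; length-value = |v|+1+b≡
    ; lower = ≤-pred (<-balance (trans |v|+1+b≡ (L⁻-suc j)) (value-<-D j s |s| ad not-exh′))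
    ; upper = subst (suc b ≤_) |v|+1+b≡ (m≤n+m (suc b) _)
    ; word = refl }
    where
    a≡ : a ≡ reached u₋₁ (topBlock p s)
    a≡ = just-injective (trans (sym first≡) (firstLetter-top j s |s| u₋₁))
    not-exh′ : ¬ Exhaustive (topBlock p s)
    not-exh′ e = not-exh (trans (cong (value η (topBlock p s) ∷ʳ_) a≡) e)
    len≡ : len ≡ length (value η s)
    len≡ = trans (sym (length-segment (- (+ length (pow η (length s) u₋₁))) len)) (cong length seg≡)
    |v|+1+b≡ : length (value η s) + suc b ≡ L⁻ (suc j)
    |v|+1+b≡ = trans (cong (_+ suc b) (sym len≡))
      (trans (Equivalence.to (-[m]+n≡-[1+o]⇔n+[1+o]≡m _ len b) pos≡) (cong (λ q → length (pow η q u₋₁)) |s|))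

  module _ {b b′ w w′} (V : RepNegView b w) (V′ : RepNegView b′ w′) where
    private
      module V = RepNegView V
      module V′ = RepNegView V′

    level⁻-≤ : b′ ≤ b → V′.level ≤ V.level
    level⁻-≤ = level-≤ L⁻-mono V′.lower V.upper

    repNeg-functional : b ≡ b′ → w ≡ w′
    repNeg-functional refl with ≤-antisym (level⁻-≤ ≤-refl) (level-≤ L⁻-mono V.lower V′.upper ≤-refl)
    ... | refl = begin
      w                 ≡⟨ V.word ⟩
      1 ∷ digits V.seq  ≡⟨ cong (λ s → 1 ∷ digits s) same-seq ⟩
      1 ∷ digits V′.seq ≡⟨ V′.word ⟨
      w′                ∎
      where
      open ≡-Reasoning
      same-seq : V.seq ≡ V′.seq
      same-seq = admissible-unique u₋₁ V.seq V′.seq V.admissible V′.admissible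
        (trans V.length-seq (sym V′.length-seq)) (+-cancelʳ-≡ _ _ _ (trans V.length-value (sym V′.length-value)))

    repNeg-increasing : b′ < b → w ≺ w′
    repNeg-increasing b′<b rewrite V.word | V′.word with m≤n⇒m<n∨m≡n (level⁻-≤ (<⇒≤ b′<b))
    ... | inj₁ j′<j = neg<neg _ _ (inj₁ (s≤s (subst₂ _<_
            (sym (length-digits-seq V′.level V′.seq V′.length-seq)) (sym (length-digits-seq V.level V.seq V.length-seq))
            (*-monoˡ-< p (s≤s j′<j)))))
    ... | inj₂ refl = neg<neg _ _ (inj₂ (cong suc (trans (length-digits V.seq) (trans V.length-seq
            (trans (sym V′.length-seq) (sym (length-digits V′.seq))))) ,
          there (admissible-<lex u₋₁ V.seq V′.seq V.admissible V′.admissible (trans V.length-seq (sym V′.length-seq))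
                   (<-balance {suc b′} (trans (+-comm (suc b′) _) (trans V′.length-value
                     (trans (sym V.length-value) (+-comm _ (suc b))))) (s≤s b′<b)))))

  repPos-exists : ∀ n → ∃ (RepPos η u p (suc n))
  repPos-exists n with u₀-growing (suc (suc n))
  ... | K , grows with level-exists L⁺ (suc n) K (s≤s z≤n) (grows (K * p) (m≤m*n K p))
  ... | j , lower , upper with admissible-exists (suc j * p) u₀ (suc n) upper
  ... | s , |s| , ad , |v|≡ = 0 ∷ digits s , j , s , |s| , ad , loud ,
          subst (λ i → segment u (+ 0) i ≡ value η s) |v|≡ (value-in-prefix (suc j) s |s| ad) , refl
    where
    loud : ¬ Silent (topBlock p s)
    loud silent = <-irrefl refl (<-≤-trans (subst (_< L⁺ j) |v|≡ (value-<-L⁺ j s |s| ad silent)) lower)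

  repNeg-exists : ∀ b → ∃ (RepNeg η u p -[1+ suc b ])
  repNeg-exists b with u₋₁-growing (suc (suc b))
  ... | K , grows with level-exists L⁻ (suc b) K (s≤s z≤n) (grows (K * p) (m≤m*n K p))
  ... | j , lower , upper
    with admissible-exists (suc j * p) u₋₁ (L⁻ (suc j) ∸ suc (suc b)) (∸-monoʳ-< (s≤s z≤n) upper)
  ... | s , |s| , ad , |v|≡ = 1 ∷ digits s , j , s , |s| , ad ,
          (reached u₋₁ (topBlock p s) , firstLetter-top j s |s| u₋₁ , not-exh) ,
          (length (value η s) , Equivalence.from (-[m]+n≡-[1+o]⇔n+[1+o]≡m _ _ (suc b)) |v|+2+b≡ ,
           value-in-suffix (suc j) s |s| ad) , refl
    where
    |v|+2+b≡L : length (value η s) + suc (suc b) ≡ L⁻ (suc j)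
    |v|+2+b≡L = trans (cong (_+ suc (suc b)) |v|≡) (m∸n+n≡m upper)
    |v|+2+b≡ : length (value η s) + suc (suc b) ≡ length (pow η (length s) u₋₁)
    |v|+2+b≡ = trans |v|+2+b≡L (cong (λ q → length (pow η q u₋₁)) (sym |s|))
    |v|<D : length (value η s) < D j
    |v|<D = <-balance
      (trans (+-comm (L⁻ j) (D j)) (trans (sym (L⁻-suc j)) (trans (sym |v|+2+b≡L) (+-comm _ (suc (suc b))))))
      (s≤s lower)
    not-exh : ¬ Exhaustive (topBlock p s)
    not-exh e = <-irrefl refl (<-≤-trans |v|<D (D-≤-value j s |s| ad e))

  Rep : ℤ → List ℕ → Set
  Rep = IsRep η u p

  rep-total : ∀ n → ∃ (Rep n)
  rep-total (+ zero)       = 0 ∷ [] , refl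
  rep-total +[1+ n ]       = repPos-exists n
  rep-total -[1+ zero ]    = 1 ∷ [] , refl
  rep-total -[1+ suc b ]   = repNeg-exists b

  rep-functional : ∀ {n w w′} → Rep n w → Rep n w′ → w ≡ w′
  rep-functional {+ zero}       e e′ = trans e (sym e′)
  rep-functional {+[1+ n ]}     r r′ = repPos-functional (repPosView r) (repPosView r′) refl
  rep-functional { -[1+ zero ]} e e′ = trans e (sym e′)
  rep-functional { -[1+ suc b ]} r r′ = repNeg-functional (repNegView r) (repNegView r′) refl

  1≤length-digits : ∀ j (s : Seq {k}) → length s ≡ suc j * p → 1 ≤ length (digits s)
  1≤length-digits j s |s| = subst (1 ≤_) (sym (length-digits-seq j s |s|)) (s≤s z≤n)

  repPos-digits : ∀ {n w} → RepPos η u p n w → ∃ λ ds → w ≡ 0 ∷ ds × 1 ≤ length ds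
  repPos-digits r = let module V = RepPosView (repPosView r) in
    digits V.seq , V.word , 1≤length-digits V.level V.seq V.length-seq

  repNeg-digits : ∀ {b w} → RepNeg η u p -[1+ b ] w → ∃ λ ds → w ≡ 1 ∷ ds × 1 ≤ length ds
  repNeg-digits r = let module V = RepNegView (repNegView r) in
    digits V.seq , V.word , 1≤length-digits V.level V.seq V.length-seq

  rep-increasing : ∀ {m n w w′} → Rep m w → Rep n w′ → m ℤ.< n → w ≺ w′
  rep-increasing {+ zero}       {+ zero}       _    _    (ℤ.+<+ ())
  rep-increasing { -[1+ zero ]} { -[1+ n ]}    _    _    (ℤ.-<- ())
  rep-increasing {+ zero}       {+[1+ n ]}     refl r′   _ with repPos-digits r′
  ... | ds , refl , 1≤ = pos<pos [] ds (inj₁ (s≤s 1≤))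
  rep-increasing {+[1+ m ]}     {+[1+ n ]}     r    r′   (ℤ.+<+ m<n) =
    repPos-increasing (repPosView r) (repPosView r′) m<n
  rep-increasing { -[1+ zero ]} {+ zero}       refl refl _ = neg<pos [] []
  rep-increasing { -[1+ zero ]} {+[1+ n ]}     refl r′   _ with repPos-digits r′
  ... | ds , refl , _ = neg<pos [] ds
  rep-increasing { -[1+ suc m ]} {+ zero}      r    refl _ with repNeg-digits r
  ... | ds , refl , _ = neg<pos ds []
  rep-increasing { -[1+ suc m ]} {+[1+ n ]}    r    r′   _ with repNeg-digits r | repPos-digits r′
  ... | ds , refl , _ | ds′ , refl , _ = neg<pos ds ds′
  rep-increasing { -[1+ suc m ]} { -[1+ zero ]} r   refl _ with repNeg-digits r
  ... | ds , refl , 1≤ = neg<neg ds [] (inj₁ (s≤s 1≤))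
  rep-increasing { -[1+ suc m ]} { -[1+ suc n ]} r  r′   (ℤ.-<- n<m) =
    repNeg-increasing (repNegView r) (repNegView r′) n<m

  Img : List ℕ → Set
  Img = InImageSet η u p

  length-∷-digits : ∀ d j (s : Seq {k}) → length s ≡ suc j * p → length (d ∷ digits s) ≡ suc j * p + 1
  length-∷-digits d j s |s| = trans (cong suc (length-digits-seq j s |s|)) (+-comm 1 (suc j * p))

  length-∷-digits⁻ : ∀ d j (s : Seq {k}) → length (d ∷ digits s) ≡ suc j * p + 1 → length s ≡ suc j * p
  length-∷-digits⁻ d j s |w| = trans (sym (length-digits s)) (suc-injective (trans |w| (+-comm _ 1)))

  rep-into : ∀ {n w} → Rep n w → Img w
  rep-into {+ zero} refl = (0 , refl) , (u₀ , refl) , (λ { (_ , ()) }) , (λ { (_ , _ , (_ , ())) })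
  rep-into { -[1+ zero ]} refl = (0 , refl) , (u₋₁ , refl) , (λ { (_ , ()) }) , no-Wmax
    where
    no-Wmax : ¬ (∃ λ W → IsWmax η u p W × Prefix {k} (1 ∷ W) (1 ∷ []))
    no-Wmax (_ , (sW , |sW| , _ , _ , refl) , 1W⊑) =
      <-irrefl refl (≤-trans (1≤length-digits 0 sW (trans |sW| (sym (+-identityʳ p))))
                             (⊑-length (proj₂ (∷⁻-⊑ 1W⊑))))
  rep-into {+[1+ n ]} (j , s , |s| , ad , loud , _ , refl) =
    (suc j , length-∷-digits 0 j s |s|) , (reached u₀ s , admissible⇒run u₀ s ad) ,
    (λ 0zeros⊑ → loud (Equivalence.from (silent-top⇔zeros⊑ j s |s|) (proj₂ (∷⁻-⊑ 0zeros⊑)))) ,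
    (λ { (_ , _ , (_ , ())) })
  rep-into { -[1+ suc b ]} r with repNegView r
  ... | V rewrite RepNegView.word V =
    (suc V.level , length-∷-digits 1 V.level V.seq V.length-seq) ,
    (reached u₋₁ V.seq , admissible⇒run u₋₁ V.seq V.admissible) ,
    (λ { (_ , ()) }) ,
    (λ { (W , Wmax , 1W⊑) → V.not-exhaustive
           (Equivalence.from (exhaustive-top⇔Wmax⊑ V.level V.seq V.length-seq V.admissible)
                             (W , Wmax , proj₂ (∷⁻-⊑ 1W⊑))) })
    where module V = RepNegView V

  repPos-from-seq : ∀ j s → length s ≡ suc j * p → Admissible η u₀ s → ¬ Silent (topBlock p s) →
    ∃ λ n → Rep n (0 ∷ digits s)
  repPos-from-seq j s |s| ad loud with length (value η s) in |v|≡
  ... | zero  = ⊥-elim (<-irrefl refl (<-≤-trans (length-pow-pos (j * p) u₀)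
                                               (subst (L⁺ j ≤_) |v|≡ (L⁺-≤-value j s |s| ad loud))))
  ... | suc n = +[1+ n ] , j , s , |s| , ad , loud ,
                subst (λ i → segment u (+ 0) i ≡ value η s) |v|≡ (value-in-prefix (suc j) s |s| ad) , refl

  repNeg-from-seq : ∀ j s → length s ≡ suc j * p → Admissible η u₋₁ s → ¬ Exhaustive (topBlock p s) →
    ∃ λ n → Rep n (1 ∷ digits s)
  repNeg-from-seq j s |s| ad not-exh =
    -[1+ suc b ] , j , s , |s| , ad , (reached u₋₁ (topBlock p s) , firstLetter-top j s |s| u₋₁ , not-exh) ,
    (length (value η s) , Equivalence.from (-[m]+n≡-[1+o]⇔n+[1+o]≡m _ _ (suc b)) |v|+2+b≡ ,
     value-in-suffix (suc j) s |s| ad) , refl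
    where
    |v| : ℕ
    |v| = length (value η s)
    2+|v|≤L : suc (suc |v|) ≤ L⁻ (suc j)
    2+|v|≤L = subst (suc (suc |v|) ≤_) (sym (L⁻-suc j))
      (subst (_≤ D j + L⁻ j) (+-comm (suc |v|) 1)
             (+-mono-≤ (value-<-D j s |s| ad not-exh) (length-pow-pos (j * p) u₋₁)))
    b : ℕ
    b = L⁻ (suc j) ∸ suc (suc |v|)
    |v|+2+b≡ : |v| + suc (suc b) ≡ length (pow η (length s) u₋₁)
    |v|+2+b≡ = begin
      |v| + suc (suc b)    ≡⟨ +-suc |v| (suc b) ⟩
      suc (|v| + suc b)    ≡⟨ cong suc (+-suc |v| b) ⟩
      suc (suc |v|) + b    ≡⟨ m+[n∸m]≡n 2+|v|≤L ⟩
      L⁻ (suc j)           ≡⟨ cong (λ q → length (pow η q u₋₁)) |s| ⟨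
      length (pow η (length s) u₋₁) ∎
      where open ≡-Reasoning

  rep-onto : ∀ {w} → Img w → ∃ λ n → Rep n w
  rep-onto {0 ∷ ds} ((zero , |w|) , _) = + 0 , cong (0 ∷_) (length≡0⇒[] (suc-injective |w|))
  rep-onto {0 ∷ ds} ((suc j , |w|) , (_ , run) , no-zeros , _) with run⇒admissible u₀ ds run
  ... | s , ad , refl = repPos-from-seq j s |s| ad
          (λ silent → no-zeros (∷⁺-⊑ (Equivalence.to (silent-top⇔zeros⊑ j s |s|) silent)))
    where
    |s| : length s ≡ suc j * p
    |s| = length-∷-digits⁻ 0 j s |w|
  rep-onto {1 ∷ ds} ((zero , |w|) , _) = -[1+ 0 ] , cong (1 ∷_) (length≡0⇒[] (suc-injective |w|))
  rep-onto {1 ∷ ds} ((suc j , |w|) , (_ , run) , _ , no-Wmax) with run⇒admissible u₋₁ ds run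
  ... | s , ad , refl = repNeg-from-seq j s |s| ad
          (λ exh → no-Wmax (let (W , Wmax , W⊑) = Equivalence.to (exhaustive-top⇔Wmax⊑ j s |s| ad) exh
                            in W , Wmax , ∷⁺-⊑ W⊑))
    where
    |s| : length s ≡ suc j * p
    |s| = length-∷-digits⁻ 1 j s |w|

nonErasing : ∀ {k} {η : Morphism {k}} → IsSubstitution η → ∀ a → 1 ≤ length (η a)
nonErasing {η = η} (η≢[] , _) a with η a | η≢[] a
... | []    | η≢ = ⊥-elim (η≢ refl)
... | _ ∷ _ | _  = s≤s z≤n

theorem22 : ∀ {k : ℕ} (η : Fin k → List (Fin k)) (u : ℤ → Fin k) (p : ℕ) →
    IsSubstitution η → GrowingSeed η u → IsPeriod η u p →
    (f : ℤ → List ℕ) → (∀ z → InLeadD η (f z)) →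
    ((∀ n → IsRep η u p n (f n))
      ⇔ (Increasing f
         × (∀ w → (Σ ℤ (λ z → f z ≡ w)) ⇔ InImageSet η u p w)
         × (f (+ 0) ≡ 0 ∷ [])))
theorem22 η u zero     _   _                          (() , _)         f _
theorem22 η u (suc p′) sub (u₋₁-growing , u₀-growing) (_ , fixed , _) f _ = graph⇔characterised f
  where
  open PeriodicPoint η (nonErasing sub) u p′ fixed u₀-growing u₋₁-growing
  open GraphCharacterisation Rep Img rep-total rep-functional rep-increasing rep-into rep-onto refl
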